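{- Let $G=(V,E)$ be a graph with $n=|V|$, $m=|E|$, and fix integers $c\ge1$, $0\le k\le n$, $\ell>k$; let ${\bf s}_G$ be the string associated to $G,c,\ell$ as in the context. Assume the minimum size of a vertex cover of $G$ is $\tau(G)=k'>k$, and let $\varphi$ be a $c$-BLZ parsing of ${\bf s}_G$ whose phrases contained in the prefix $\alpha^{(1)}$ number $4n+6m+t$ for some integer $t\le k$. Then there are at least $z=k'-t$ positions of $\alpha^{(1)}$, each having hop-number at least $2$ under $\varphi$, and lying in pairwise distinct substrings $Y_j$ of $\alpha^{(1)}$.
   Context: Strings: for ${\bf s}=s_1\dots s_N$, ${\bf s}[i,j]=s_i\dots s_j$. A parsing of ${\bf s}$ is a partition into consecutive nonempty substrings (phrases); its size is the number of phrases. An LZ-parsing is a parsing in which every phrase ${\bf s}[a,e]$ either has length $1$, or is given together with a chosen source start $b$ with $1\le b\le a-1$ and ${\bf s}[b,b+(e-a)-1]={\bf s}[a,e-1]$ (overlap allowed); each position $a+t$, $0\le t\le e-a-1$, then has source position $b+(t\bmod(a-b))$. The hop-number of position $p$ is $0$ if $p$ is the last position of a phrase and $hop(q)+1$ otherwise, where $q$ is the source position of $p$. A $c$-BLZ parsing is an LZ-parsing in which every hop-number is at most $c$. Construction: $G$ is simple undirected with $V=\{v_1,\dots,v_n\}$, $E=\{e_1,\dots,e_m\}$; for each edge $e_i$ fix an ordering $(v_p,v_q)$ of its endpoints. Use pairwise distinct symbols $v_i,v_i',\#^v_i$ ($i\in[n]$), $e_i,\$_i,\#^e_i$ ($i\in[m]$),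 $\#^p_t$ ($t\in[n+m]$), $\#^{(i)}_\gamma$ ($1\le i\le c-1$, $1\le\gamma\le\ell$). $P=v_1\#^p_1\cdots v_n\#^p_n e_1\#^p_{n+1}\cdots e_m\#^p_{n+m}$; $X_i=v_i'v_i\#^v_i$, $X=X_1\cdots X_n$; for $e_i=(v_p,v_q)$, $Y_i=v_p'\,v_p\,e_i\,\$_i\,v_q'\,v_q\,e_i\,\$_i\,\#^e_i$, $Y=Y_1\cdots Y_m$; $\alpha^{(1)}=PXY$ (whose last symbol $\#^e_m$ occurs only once in ${\bf s}_G$, so $\alpha^{(1)}$ ends at a phrase boundary of any LZ-parsing); $\beta^{(i)}=\alpha^{(i)}\#^{(i)}_1\cdots\alpha^{(i)}\#^{(i)}_\ell$, $\alpha^{(i+1)}=\alpha^{(i)}\beta^{(i)}$; ${\bf s}_G=\alpha^{(c)}$. A vertex cover of $G$ is a set of vertices meeting every edge. -}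

module Defs where

open import Data.Nat using (ℕ; zero; suc; _+_; _*_; _∸_; _≤_; _<_; _≤?_; _≤ᵇ_; _<ᵇ_; _≡ᵇ_; _%_)
open import Data.Bool using (Bool; if_then_else_; _∧_)
open import Data.List using (List; []; _∷_; _++_; concatMap; upTo; allFin; length; map; filter)
open import Data.Nat.ListAction using (sum)
open import Data.List.Relation.Unary.All using (All)
open import Data.Maybe using (Maybe; just; nothing)
open import Data.Product using (Σ; _×_; _,_; proj₁; proj₂)
open import Data.Sum using (_⊎_)
open import Data.Fin using (Fin; toℕ)
open import Data.Fin.Subset using (Subset; _∈_; ∣_∣)
open import Relation.Binary.PropositionalEquality using (_≡_; _≢_)

-- Simple undirected graphs on vertices Fin n with edges Fin m.
-- Each edge e_i comes with a fixed ordering (v_p , v_q) of its endpoints.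

SameEdge : ∀ {n} → Fin n × Fin n → Fin n × Fin n → Set
SameEdge (a , b) (c , d) = (a ≡ c × b ≡ d) ⊎ (a ≡ d × b ≡ c)

record Graph (n m : ℕ) : Set where
  field
    edge    : Fin m → Fin n × Fin n
    noLoop  : ∀ i → proj₁ (edge i) ≢ proj₂ (edge i)
    noMulti : ∀ i j → SameEdge (edge i) (edge j) → i ≡ j
open Graph public

IsVertexCover : ∀ {n m} → Graph n m → Subset n → Set
IsVertexCover G S = ∀ i → (proj₁ (edge G i) ∈ S) ⊎ (proj₂ (edge G i) ∈ S)

MinVertexCoverSize : ∀ {n m} → Graph n m → ℕ → Set
MinVertexCoverSize {n} G k =
  (Σ (Subset n) λ S → IsVertexCover G S × ∣ S ∣ ≡ k) ×
  (∀ (S : Subset n) → IsVertexCover G S → k ≤ ∣ S ∣)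

-- Symbols (pairwise distinct by constructor / index)

data Sym : Set where
  sv sv' hv : ℕ → Sym          -- v_i , v_i' , #^v_i
  se dol he : ℕ → Sym          -- e_i , $_i , #^e_i
  hp        : ℕ → Sym          -- #^p_t
  hh        : ℕ → ℕ → Sym      -- #^{(i)}_γ

module _ {n m : ℕ} (G : Graph n m) where

  Pstr : List Sym
  Pstr = concatMap (λ i → sv i ∷ hp i ∷ []) (upTo n)
      ++ concatMap (λ i → se i ∷ hp (n + i) ∷ []) (upTo m)

  Xstr : List Sym
  Xstr = concatMap (λ i → sv' i ∷ sv i ∷ hv i ∷ []) (upTo n)

  Yblock : Fin m → List Sym
  Yblock j with edge G j
  ... | (p , q) = sv' (toℕ p) ∷ sv (toℕ p) ∷ se (toℕ j) ∷ dol (toℕ j)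
                ∷ sv' (toℕ q) ∷ sv (toℕ q) ∷ se (toℕ j) ∷ dol (toℕ j)
                ∷ he (toℕ j) ∷ []

  Ystr : List Sym
  Ystr = concatMap Yblock (allFin m)

  alpha1 : List Sym
  alpha1 = Pstr ++ Xstr ++ Ystr

  -- 0-indexed starting position of the block Y_j inside alpha1 (|Y_j| = 9)
  Yoffset : Fin m → ℕ
  Yoffset j = length (Pstr ++ Xstr) + 9 * toℕ j

  beta : ℕ → ℕ → List Sym → List Sym
  beta i ℓ a = concatMap (λ γ → a ++ hh i γ ∷ []) (upTo ℓ)

  -- alphaSeq ℓ i = α^(i+1)
  alphaSeq : ℕ → ℕ → List Sym
  alphaSeq ℓ zero    = alpha1
  alphaSeq ℓ (suc i) = alphaSeq ℓ i ++ beta (suc i) ℓ (alphaSeq ℓ i)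

  -- s_G = α^(c)   (used with c ≥ 1)
  sG : ℕ → ℕ → List Sym
  sG c ℓ = alphaSeq ℓ (c ∸ 1)

-- Parsings (positions are 0-indexed).  A phrase has a length and an
-- optional source start b (0-indexed).

record Phrase : Set where
  constructor phrase
  field
    len : ℕ
    src : Maybe ℕ
open Phrase public

Parsing : Set
Parsing = List Phrase

starts : ℕ → Parsing → List (ℕ × Phrase)
starts a []       = []
starts a (f ∷ φ)  = (a , f) ∷ starts (a + len f) φ

at : ∀ {A : Set} → List A → ℕ → Maybe A
at []       _       = nothing
at (x ∷ xs) zero    = just x
at (x ∷ xs) (suc i) = at xs i

IsParsing : List Sym → Parsing → Set
IsParsing s φ = All (λ x → 1 ≤ len (proj₂ x)) (starts 0 φ) × sum (map len φ) ≡ length s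

SourceOK : List Sym → ℕ × Phrase → Set
SourceOK s (a , phrase L nothing)  = L ≡ 1
SourceOK s (a , phrase L (just b)) =
  b < a × (∀ t → suc t < L → at s (b + t) ≡ at s (a + t))

IsLZParsing : List Sym → Parsing → Set
IsLZParsing s φ = IsParsing s φ × All (SourceOK s) (starts 0 φ)

-- t mod d (the d = 0 case never arises for LZ-parsings since b < a)
modN : ℕ → ℕ → ℕ
modN t zero    = t
modN t (suc d) = t % suc d

srcPos : ℕ → ℕ → ℕ → ℕ
srcPos a b t = b + modN t (a ∸ b)

findPhrase : ℕ → List (ℕ × Phrase) → Maybe (ℕ × Phrase)
findPhrase p []             = nothing
findPhrase p ((a , f) ∷ r)  =
  if (a ≤ᵇ p) ∧ (p <ᵇ a + len f) then just (a , f) else findPhrase p r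

-- hop-number with fuel (source positions are strictly smaller, so fuel
-- p+1 suffices for position p)
hopF : ℕ → List (ℕ × Phrase) → ℕ → ℕ
hopF zero    ps p = 0
hopF (suc k) ps p with findPhrase p ps
... | nothing                       = 0
... | just (a , phrase L nothing)   = 0
... | just (a , phrase L (just b))  =
  if suc p ≡ᵇ a + L then 0 else suc (hopF k ps (srcPos a b (p ∸ a)))

hop : Parsing → ℕ → ℕ
hop φ p = hopF (suc p) (starts 0 φ) p

IsBLZParsing : ℕ → List Sym → Parsing → Set
IsBLZParsing c s φ = IsLZParsing s φ × (∀ p → p < length s → hop φ p ≤ c)

prefixPhraseCount : ℕ → Parsing → ℕ
prefixPhraseCount N φ =
  length (filter (λ x → proj₁ x + len (proj₂ x) ≤? N) (starts 0 φ))

-- A symbol occurring for the first time ends a phrase: so do all of P, v'_i and #^v_i in X_i, and $_j, #^e_j in Y_j.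
-- The pairs v_p e_j and v_q e_j are new as well, so every Y_j holds at least four phrase ends, plus one for each of
-- its copies v'_p, v'_q that ends a phrase. Let C contain i when v_i ends a phrase in X_i, p (resp. q) when v'_p (resp.
-- v'_q) ends a phrase in Y_j, and p when Y_j has neither but contains a hop-number ≥ 2 or a fifth phrase end. In every
-- other block all hop-numbers are ≤ 1 and the four forced ends are the only ones; then some phrase starts with a copy
-- v'_u v_u of an endpoint u, the sources of both copied symbols have hop-number 0 and hence end phrases, and the source
-- of v'_u is an earlier v'_u, in X_u or in a block at u, which already put u into C. So C is a vertex cover, |C| ≥ k',
-- and comparing the phrase ends of α^(1) with its 4n + 6m + t phrases leaves k' − t blocks with a hop-number ≥ 2.

module Submission where

open import Defs
open import Data.Bool using (Bool; true; false; T; _∨_; if_then_else_)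
open import Data.Empty using (⊥; ⊥-elim)
open import Data.Fin using (Fin; toℕ; fromℕ<; #_) renaming (zero to fzero; suc to fsuc)
open import Data.Fin.Properties using (toℕ<n; toℕ-fromℕ<; toℕ-injective; any?) renaming (suc-injective to fsuc-injective)
open import Data.Fin.Subset using (Subset; _∪_; ⁅_⁆; ∣_∣; outside; inside) renaming (⊥ to ∅; _∈_ to _∈ₛ_)
open import Data.Fin.Subset.Properties using (∣p∣≤∣x∷p∣; ∣⊥∣≡0; ∣⁅x⁆∣≡1; x∈⁅x⁆; x∈p∪q⁺)
open import Data.Integer as ℤ using (ℤ)
import Data.Integer.Properties as ℤₚ
import Data.Integer.Tactic.RingSolver as ℤ-Solver
open import Data.List using (List; []; _∷_; _++_; length; map; filter; foldr; concatMap; applyUpTo; tabulate; upTo; allFin)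
open import Data.List.Properties using (length-++; length-map; map-∘; filter-accept; length-++-≤ˡ; length-applyUpTo; length-tabulate; ++-assoc; ++-identityʳ)
open import Data.List.Membership.Propositional using (_∈_)
open import Data.List.Membership.Propositional.Properties using (∈-++⁺ˡ; ∈-++⁺ʳ)
open import Data.List.Relation.Unary.All as All using (All; []; _∷_; universal)
import Data.List.Relation.Unary.All.Properties as Allₚ
open import Data.List.Relation.Unary.AllPairs using ([]; _∷_)
open import Data.List.Relation.Unary.Any using (here; there)
open import Data.List.Relation.Unary.Unique.Propositional using (Unique)
import Data.List.Relation.Unary.Unique.Propositional.Properties as Unique
open import Data.Maybe using (Maybe; just; nothing; is-just; _>>=_)
open import Data.Maybe.Properties using (just-injective)
open import Data.Nat using (ℕ; zero; suc; _+_; _*_; _∸_; _≤_; _<_; _≤?_; _<?_; _≟_; _≤ᵇ_; _<ᵇ_; _≡ᵇ_; z≤n; s≤s; s≤s⁻¹; z<s; NonZero; >-nonZero)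
open import Data.Nat.DivMod using (_%_; _/_; m%n<n; m<n⇒m%n≡m; m≡m%n+[m/n]*n; m<n*o⇒m/o<n)
open import Data.Nat.ListAction using (sum)
open import Data.Nat.Properties
open import Algebra.Properties.CommutativeSemigroup +-commutativeSemigroup using () renaming (x∙yz≈y∙xz to x+[y+z]≡y+[x+z])
open import Data.Nat.Tactic.RingSolver using (solve-∀)
open import Data.Product using (Σ; ∃; ∃₂; _×_; _,_; proj₁; proj₂)
open import Data.Sum using (_⊎_; inj₁; inj₂)
import Data.Sum as Sum
open import Data.Unit using (tt)
open import Data.Vec using ([]; _∷_)
open import Function using (_∘_; id)
open import Relation.Nullary using (¬_)
open import Relation.Nullary.Decidable using (Dec; yes; no; dec-false; dec⇒maybe)
open import Relation.Binary.PropositionalEquality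

at-++ˡ : ∀ {A : Set} (xs ys : List A) {i} → i < length xs → at (xs ++ ys) i ≡ at xs i
at-++ˡ (x ∷ xs) ys {zero}  _   = refl
at-++ˡ (x ∷ xs) ys {suc i} i<n = at-++ˡ xs ys (s≤s⁻¹ i<n)

at-++ʳ : ∀ {A : Set} (xs ys : List A) i → at (xs ++ ys) (length xs + i) ≡ at ys i
at-++ʳ []       ys i = refl
at-++ʳ (x ∷ xs) ys i = at-++ʳ xs ys i

at-just⇒< : ∀ {A : Set} (xs : List A) i {x} → at xs i ≡ just x → i < length xs
at-just⇒< (y ∷ xs) zero    _ = z<s
at-just⇒< (y ∷ xs) (suc i) e = s≤s (at-just⇒< xs i e)

module _ {A B : Set} (g : A → List B) (k : ℕ) (|g|≡k : ∀ x → length (g x) ≡ k) where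

  length-concatMap : ∀ xs → length (concatMap g xs) ≡ k * length xs
  length-concatMap []       = sym (*-zeroʳ k)
  length-concatMap (x ∷ xs) = begin
    length (g x ++ concatMap g xs)        ≡⟨ length-++ (g x) ⟩
    length (g x) + length (concatMap g xs) ≡⟨ cong₂ _+_ (|g|≡k x) (length-concatMap xs) ⟩
    k + k * length xs                      ≡⟨ *-suc k (length xs) ⟨
    k * suc (length xs)                    ∎
    where open ≡-Reasoning

  at-concatMap : ∀ xs i {o} → o < k → at (concatMap g xs) (o + k * i) ≡ (at xs i >>= λ x → at (g x) o)
  at-concatMap []       i       o<k = refl
  at-concatMap (x ∷ xs) zero    {o} o<k = begin
    at (g x ++ concatMap g xs) (o + k * 0) ≡⟨ cong (at (g x ++ concatMap g xs)) (trans (cong (o +_) (*-zeroʳ k)) (+-identityʳ o)) ⟩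
    at (g x ++ concatMap g xs) o           ≡⟨ at-++ˡ (g x) (concatMap g xs) (subst (o <_) (sym (|g|≡k x)) o<k) ⟩
    at (g x) o                             ∎
    where open ≡-Reasoning
  at-concatMap (x ∷ xs) (suc i) {o} o<k = begin
    at (g x ++ concatMap g xs) (o + k * suc i)            ≡⟨ cong (at (g x ++ concatMap g xs)) shift ⟩
    at (g x ++ concatMap g xs) (length (g x) + (o + k * i)) ≡⟨ at-++ʳ (g x) (concatMap g xs) (o + k * i) ⟩
    at (concatMap g xs) (o + k * i)                        ≡⟨ at-concatMap xs i o<k ⟩
    (at xs i >>= λ y → at (g y) o)                         ∎
    where
    open ≡-Reasoning
    shift : o + k * suc i ≡ length (g x) + (o + k * i)
    shift = trans (rearrange o k i) (cong (_+ (o + k * i)) (sym (|g|≡k x)))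
      where
      rearrange : ∀ o k i → o + k * suc i ≡ k + (o + k * i)
      rearrange = solve-∀

  at-concatMap-lookup : ∀ xs {i o x} → at xs i ≡ just x → o < k → at (concatMap g xs) (o + k * i) ≡ at (g x) o
  at-concatMap-lookup xs {i} {o} xs[i] o<k = trans (at-concatMap xs i o<k) (cong (_>>= λ y → at (g y) o) xs[i])

at-applyUpTo : ∀ {A : Set} (f : ℕ → A) n {i} → i < n → at (applyUpTo f n) i ≡ just (f i)
at-applyUpTo f (suc n) {zero}  _   = refl
at-applyUpTo f (suc n) {suc i} i<n = at-applyUpTo (f ∘ suc) n (s≤s⁻¹ i<n)

at-tabulate : ∀ {A : Set} {m} (f : Fin m → A) j → at (tabulate f) (toℕ j) ≡ just (f j)
at-tabulate f fzero    = refl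
at-tabulate f (fsuc j) = at-tabulate (f ∘ fsuc) j

divide-into-blocks : ∀ r k n .{{_ : NonZero k}} → r < k * n → ∃₂ λ i o → i < n × o < k × r ≡ o + k * i
divide-into-blocks r k n r<kn =
  r / k , r % k , m<n*o⇒m/o<n (subst (r <_) (*-comm k n) r<kn) , m%n<n r k ,
  trans (m≡m%n+[m/n]*n r k) (cong (r % k +_) (*-comm (r / k) k))

-- Phrases and hop-numbers of an LZ-parsing

findPhrase-∷ : ∀ p a f ps →
  (findPhrase p ((a , f) ∷ ps) ≡ just (a , f) × a ≤ p × p < a + len f) ⊎
  (findPhrase p ((a , f) ∷ ps) ≡ findPhrase p ps × (a ≤ p → a + len f ≤ p))
findPhrase-∷ p a f ps with a ≤ᵇ p in a≤ᵇp | p <ᵇ a + len f in p<ᵇe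
... | true  | true  = inj₁ (refl , ≤ᵇ⇒≤ a p (subst T (sym a≤ᵇp) tt) , <ᵇ⇒< p (a + len f) (subst T (sym p<ᵇe) tt))
... | true  | false = inj₂ (refl , λ _ → ≮⇒≥ (λ p<e → subst T p<ᵇe (<⇒<ᵇ p<e)))
... | false | _     = inj₂ (refl , λ a≤p → ⊥-elim (subst T a≤ᵇp (≤⇒≤ᵇ a≤p)))

findPhrase-sound : ∀ p ps {a f} → findPhrase p ps ≡ just (a , f) → (a , f) ∈ ps × a ≤ p × p < a + len f
findPhrase-sound p ((a′ , f′) ∷ ps) found with findPhrase-∷ p a′ f′ ps
... | inj₁ (e , a≤p , p<e) with just-injective (trans (sym e) found)
...   | refl = here refl , a≤p , p<e
findPhrase-sound p ((a′ , f′) ∷ ps) found | inj₂ (e , _) with findPhrase-sound p ps (trans (sym e) found)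
... | x∈ps , a≤p , p<e = there x∈ps , a≤p , p<e

starts-≥ : ∀ a₀ φ {a f} → (a , f) ∈ starts a₀ φ → a₀ ≤ a
starts-≥ a₀ (f₀ ∷ φ) (here refl) = ≤-refl
starts-≥ a₀ (f₀ ∷ φ) (there x∈) = ≤-trans (m≤m+n a₀ (len f₀)) (starts-≥ (a₀ + len f₀) φ x∈)

findPhrase-complete : ∀ p a₀ φ {a f} → (a , f) ∈ starts a₀ φ → a ≤ p → p < a + len f →
                      findPhrase p (starts a₀ φ) ≡ just (a , f)
findPhrase-complete p a₀ (f₀ ∷ φ) x∈ a≤p p<e with findPhrase-∷ p a₀ f₀ (starts (a₀ + len f₀) φ) | x∈
... | inj₁ (e , _)            | here refl = e
... | inj₂ (_ , past)         | here refl = ⊥-elim (<⇒≱ p<e (past a≤p))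
... | inj₁ (_ , _ , p<a₀+l₀)  | there x∈′ = ⊥-elim (<⇒≱ p<a₀+l₀ (≤-trans (starts-≥ (a₀ + len f₀) φ x∈′) a≤p))
... | inj₂ (e , _)            | there x∈′ = trans e (findPhrase-complete p (a₀ + len f₀) φ x∈′ a≤p p<e)

findPhrase-total : ∀ p a₀ φ → a₀ ≤ p → p < a₀ + sum (map len φ) → ∃ λ x → findPhrase p (starts a₀ φ) ≡ just x
findPhrase-total p a₀ []       a₀≤p p<a₀ = ⊥-elim (<⇒≱ p<a₀ (subst (_≤ p) (sym (+-identityʳ a₀)) a₀≤p))
findPhrase-total p a₀ (f₀ ∷ φ) a₀≤p p<end with findPhrase-∷ p a₀ f₀ (starts (a₀ + len f₀) φ)
... | inj₁ (e , _) = _ , e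
... | inj₂ (e , past) with findPhrase-total p (a₀ + len f₀) φ (past a₀≤p) (subst (p <_) (sym (+-assoc a₀ (len f₀) _)) p<end)
...   | x , found = x , trans e found

endsAt : ℕ → Maybe (ℕ × Phrase) → Bool
endsAt p nothing        = false
endsAt p (just (a , f)) = suc p ≡ᵇ a + len f

isPhraseEnd : List (ℕ × Phrase) → ℕ → Bool
isPhraseEnd ps p = endsAt p (findPhrase p ps)

hopF-unfold : ∀ k ps p {a L b} → findPhrase p ps ≡ just (a , phrase L (just b)) →
              hopF (suc k) ps p ≡ (if suc p ≡ᵇ a + L then 0 else suc (hopF k ps (srcPos a b (p ∸ a))))
hopF-unfold k ps p found with findPhrase p ps
hopF-unfold k ps p refl | _ = refl

srcPos-< : ∀ a b t → b < a → srcPos a b t < a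
srcPos-< a b t b<a with a ∸ b in a∸b
... | zero  = ⊥-elim (<⇒≱ (m<n⇒0<n∸m b<a) (≤-reflexive a∸b))
... | suc d = subst (b + t % suc d <_) (trans (cong (b +_) (sym a∸b)) (m+[n∸m]≡n (<⇒≤ b<a)))
                    (+-monoʳ-< b (m%n<n t (suc d)))

srcPos-offset : ∀ a b t → t < a ∸ b → srcPos a b t ≡ b + t
srcPos-offset a b t t<a-b with a ∸ b
... | zero  = ⊥-elim (n≮0 t<a-b)
... | suc d = cong (b +_) (m<n⇒m%n≡m t<a-b)

-- Sources lie strictly before their phrases, so every fuel above q yields the same hop-number of q.
hopF-fuel : ∀ ps → (∀ q {a L b} → findPhrase q ps ≡ just (a , phrase L (just b)) → b < a) →
            ∀ k k′ q → q < k → q < k′ → hopF k ps q ≡ hopF k′ ps q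
hopF-fuel ps src< (suc k) (suc k′) q q<k q<k′ with findPhrase q ps in found
... | nothing                      = refl
... | just (a , phrase L nothing)  = refl
... | just (a , phrase L (just b)) =
  cong (λ h → if suc q ≡ᵇ a + L then 0 else suc h)
       (hopF-fuel ps src< k k′ _ (<-≤-trans src<q (s≤s⁻¹ q<k)) (<-≤-trans src<q (s≤s⁻¹ q<k′)))
  where
  src<q : srcPos a b (q ∸ a) < q
  src<q = <-≤-trans (srcPos-< a b (q ∸ a) (src< q found)) (proj₁ (proj₂ (findPhrase-sound q ps found)))

≡ᵇ-false⇒≢ : ∀ {m n} → (m ≡ᵇ n) ≡ false → m ≢ n
≡ᵇ-false⇒≢ {m} {n} m≢ᵇn m≡n = subst T m≢ᵇn (≡⇒≡ᵇ m n m≡n)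

module Phrases (α rest : List Sym) (φ : Parsing) (lz : IsLZParsing (α ++ rest) φ) where

  private
    s : List Sym
    s = α ++ rest

    ps : List (ℕ × Phrase)
    ps = starts 0 φ

    sourceOK : ∀ {x} → x ∈ ps → SourceOK s x
    sourceOK = All.lookup (proj₂ lz)

    src< : ∀ q {a L b} → findPhrase q ps ≡ just (a , phrase L (just b)) → b < a
    src< q found = proj₁ (sourceOK (proj₁ (findPhrase-sound q ps found)))

    at-α : ∀ {r} → r < length α → at s r ≡ at α r
    at-α = at-++ˡ α rest

    at-α-copy : ∀ {x y} → x < length α → y < length α → at s x ≡ at s y → at α x ≡ at α y
    at-α-copy x<|α| y<|α| e = trans (sym (at-α x<|α|)) (trans e (at-α y<|α|))

    <|s| : ∀ {r} → r < length α → r < length s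
    <|s| r<|α| = <-≤-trans r<|α| (length-++-≤ˡ α)

  isEnd : ℕ → Bool
  isEnd = isPhraseEnd ps

  record Copied (p a L b : ℕ) : Set where
    field
      found   : findPhrase p ps ≡ just (a , phrase L (just b))
      a≤p     : a ≤ p
      p+1<a+L : suc p < a + L
      b<a     : b < a
      copies  : ∀ t → suc t < L → at s (b + t) ≡ at s (a + t)
      hop-suc : hop φ p ≡ suc (hop φ (srcPos a b (p ∸ a)))

  copied : ∀ {p a L b} → findPhrase p ps ≡ just (a , phrase L (just b)) → isEnd p ≡ false → Copied p a L b
  copied {p} {a} {L} {b} found notEnd = record
    { found   = found
    ; a≤p     = a≤p
    ; p+1<a+L = ≤∧≢⇒< p<a+L (≡ᵇ-false⇒≢ (trans (sym (cong (endsAt p) found)) notEnd))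
    ; b<a     = proj₁ (sourceOK x∈ps)
    ; copies  = proj₂ (sourceOK x∈ps)
    ; hop-suc = begin
        hopF (suc p) ps p                                       ≡⟨ hopF-unfold p ps p found ⟩
        (if suc p ≡ᵇ a + L then 0 else suc (hopF p ps q))        ≡⟨ cong (λ e → if e then 0 else suc (hopF p ps q)) notEnd′ ⟩
        suc (hopF p ps q)                                       ≡⟨ cong suc (hopF-fuel ps src< p (suc q) q q<p ≤-refl) ⟩
        suc (hop φ q)                                           ∎ }
    where
    open ≡-Reasoning
    sound : (a , phrase L (just b)) ∈ ps × a ≤ p × p < a + L
    sound = findPhrase-sound p ps found
    x∈ps : (a , phrase L (just b)) ∈ ps
    x∈ps = proj₁ sound
    a≤p : a ≤ p
    a≤p = proj₁ (proj₂ sound)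
    p<a+L : p < a + L
    p<a+L = proj₂ (proj₂ sound)
    notEnd′ : (suc p ≡ᵇ a + L) ≡ false
    notEnd′ = trans (sym (cong (endsAt p) found)) notEnd
    q : ℕ
    q = srcPos a b (p ∸ a)
    q<p : q < p
    q<p = <-≤-trans (srcPos-< a b (p ∸ a) (src< p found)) a≤p

  nonEnd⇒copied : ∀ {p} → p < length s → isEnd p ≡ false → ∃ λ a → ∃ λ L → ∃ λ b → Copied p a L b
  nonEnd⇒copied {p} p<|s| notEnd with findPhrase-total p 0 φ z≤n (subst (p <_) (sym (proj₂ (proj₁ lz))) p<|s|)
  ... | (a , phrase L (just b)) , found = a , L , b , copied found notEnd
  ... | (a , phrase L nothing)  , found = ⊥-elim (≡ᵇ-false⇒≢ (trans (sym (cong (endsAt p) found)) notEnd) p+1≡a+L)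
    where
    sound : (a , phrase L nothing) ∈ ps × a ≤ p × p < a + L
    sound = findPhrase-sound p ps found
    L≡1 : L ≡ 1
    L≡1 = sourceOK (proj₁ sound)
    p≤a : p ≤ a
    p≤a = s≤s⁻¹ (subst (suc p ≤_) (trans (cong (a +_) L≡1) (+-comm a 1)) (proj₂ (proj₂ sound)))
    p+1≡a+L : suc p ≡ a + L
    p+1≡a+L = trans (cong suc (≤-antisym p≤a (proj₁ (proj₂ sound)))) (trans (+-comm 1 a) (cong (a +_) (sym L≡1)))

  copied-next : ∀ {p a L b} → Copied p a L b → isEnd (suc p) ≡ false → Copied (suc p) a L b
  copied-next c notEnd = copied (findPhrase-complete _ 0 φ (proj₁ (findPhrase-sound _ ps found)) (m≤n⇒m≤1+n a≤p) p+1<a+L) notEnd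
    where open Copied c

  hop≡0⇒end : ∀ {p} → p < length α → hop φ p ≡ 0 → isEnd p ≡ true
  hop≡0⇒end {p} p<|α| hop≡0 with isEnd p in e
  ... | true  = refl
  ... | false with nonEnd⇒copied (<|s| p<|α|) e
  ...   | _ , _ , _ , c = ⊥-elim (0≢1+n (trans (sym hop≡0) (Copied.hop-suc c)))

  end⇒next-start : ∀ {p a f} → isEnd p ≡ true → findPhrase (suc p) ps ≡ just (a , f) → a ≡ suc p
  end⇒next-start {p} {a} {f} end found = case-split (m≤n⇒m<n∨m≡n a≤p+1)
    where
    sound : (a , f) ∈ ps × a ≤ suc p × suc p < a + len f
    sound = findPhrase-sound (suc p) ps found
    a≤p+1 : a ≤ suc p
    a≤p+1 = proj₁ (proj₂ sound)
    p+1<a+l : suc p < a + len f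
    p+1<a+l = proj₂ (proj₂ sound)
    case-split : a < suc p ⊎ a ≡ suc p → a ≡ suc p
    case-split (inj₂ a≡p+1) = a≡p+1
    case-split (inj₁ a<p+1) = ⊥-elim (<⇒≢ p+1<a+l (≡ᵇ⇒≡ (suc p) (a + len f) (subst T (sym end′) _)))
      where
      end′ : (suc p ≡ᵇ a + len f) ≡ true
      end′ = trans (sym (cong (endsAt p) (findPhrase-complete p 0 φ (proj₁ sound) (s≤s⁻¹ a<p+1) (<-trans (n<1+n p) p+1<a+l)))) end

  private
    module Offset {p a L b} (c : Copied p a L b) where
      open Copied c public
      t : ℕ
      t = p ∸ a

      a+t≡p : a + t ≡ p
      a+t≡p = m+[n∸m]≡n a≤p

      b+t<p : b + t < p
      b+t<p = subst (b + t <_) a+t≡p (+-monoˡ-< t b<a)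

      t+1<L : suc t < L
      t+1<L = +-cancelˡ-< a (suc t) L (subst (_< a + L) (trans (cong suc (sym a+t≡p)) (sym (+-suc a t))) p+1<a+L)

      copy : at s (b + t) ≡ at s p
      copy = trans (copies t t+1<L) (cong (at s) a+t≡p)

      hop-copy : t < a ∸ b → hop φ p ≡ suc (hop φ (b + t))
      hop-copy t<a-b = trans hop-suc (cong (λ x → suc (hop φ x)) (srcPos-offset a b t t<a-b))

  new-symbol⇒end : ∀ {p} → p < length α → (∀ {r} → r < p → at α r ≢ at α p) → isEnd p ≡ true
  new-symbol⇒end {p} p<|α| new with isEnd p in e
  ... | true  = refl
  ... | false with nonEnd⇒copied (<|s| p<|α|) e
  ...   | a , L , b , c = ⊥-elim (new b+t<p (at-α-copy (<-trans b+t<p p<|α|) p<|α| copy))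
    where open Offset c

  new-pair⇒end : ∀ {p} → suc p < length α → (∀ {r} → r < p → at α r ≡ at α p → at α (suc r) ≢ at α (suc p)) →
                 T (isEnd p ∨ isEnd (suc p))
  new-pair⇒end {p} p+1<|α| new with isEnd p in e₀ | isEnd (suc p) in e₁
  ... | true  | _    = _
  ... | false | true = _
  ... | false | false with nonEnd⇒copied (<|s| (<-trans (n<1+n p) p+1<|α|)) e₀
  ...   | a , L , b , c = new b+t<p (at-α-copy (<-trans b+t<p p<|α|) p<|α| copy)
                              (at-α-copy (≤-trans (s≤s b+t<p) (<⇒≤ p+1<|α|)) p+1<|α| (trans (cong (at s) b+t+1≡) (Offset.copy c′)))
    where
    open Offset c
    p<|α| : p < length α
    p<|α| = <-trans (n<1+n p) p+1<|α|
    c′ : Copied (suc p) a L b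
    c′ = copied-next c e₁
    b+t+1≡ : suc (b + t) ≡ b + Offset.t c′
    b+t+1≡ = trans (sym (+-suc b t)) (cong (b +_) (sym (+-∸-assoc 1 a≤p)))

  record CopiedStart (q : ℕ) : Set where
    field
      source : ℕ
      source<q : source < q
      copy₀  : at α source ≡ at α q
      copy₁  : at α (suc source) ≡ at α (suc q)
      hop₀   : hop φ q ≡ suc (hop φ source)
      hop₁   : hop φ (suc q) ≡ suc (hop φ (suc source))

  copiedStart : ∀ {p} → isEnd p ≡ true → suc (suc p) < length α → isEnd (suc p) ≡ false → isEnd (suc (suc p)) ≡ false →
                at α (suc p) ≢ at α (suc (suc p)) → CopiedStart (suc p)
  copiedStart {p} end p+2<|α| notEnd₁ notEnd₂ distinct with nonEnd⇒copied (<|s| (<-trans (n<1+n (suc p)) p+2<|α|)) notEnd₁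
  ... | a , L , b , c₁ with end⇒next-start end (Copied.found c₁)
  ...   | refl = record
    { source   = b
    ; source<q = b<p+1
    ; copy₀ = copy₀
    ; copy₁ = copy₁
    ; hop₀  = trans (Offset.hop-copy c₁ (subst (_< suc p ∸ b) (sym t₁≡0) (m<n⇒0<n∸m b<p+1))) (cong (λ x → suc (hop φ x)) b+t₁≡b)
    ; hop₁  = trans (Offset.hop-copy c₂ (subst (_< suc p ∸ b) (sym t₂≡1) 1<p+1-b)) (cong (λ x → suc (hop φ x)) (sym b+t₂≡b+1))
    }
    where
    b<p+1 : b < suc p
    b<p+1 = Copied.b<a c₁
    c₂ : Copied (suc (suc p)) (suc p) L b
    c₂ = copied-next c₁ notEnd₂
    t₁≡0 : Offset.t c₁ ≡ 0
    t₁≡0 = n∸n≡0 p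
    t₂≡1 : Offset.t c₂ ≡ 1
    t₂≡1 = m+n∸n≡m 1 p
    b+t₁≡b : b + Offset.t c₁ ≡ b
    b+t₁≡b = trans (cong (b +_) t₁≡0) (+-identityʳ b)
    b+t₂≡b+1 : suc b ≡ b + Offset.t c₂
    b+t₂≡b+1 = trans (+-comm 1 b) (cong (b +_) (sym t₂≡1))
    p+1<|α| : suc p < length α
    p+1<|α| = <-trans (n<1+n (suc p)) p+2<|α|
    copy₀ : at α b ≡ at α (suc p)
    copy₀ = at-α-copy (<-trans b<p+1 p+1<|α|) p+1<|α| (trans (cong (at s) (sym b+t₁≡b)) (Offset.copy c₁))
    copy₁ : at α (suc b) ≡ at α (suc (suc p))
    copy₁ = at-α-copy (≤-trans (s≤s b<p+1) (<⇒≤ p+2<|α|)) p+2<|α| (trans (cong (at s) b+t₂≡b+1) (Offset.copy c₂))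
    b<p : b < p
    b<p with m≤n⇒m<n∨m≡n (s≤s⁻¹ b<p+1)
    ... | inj₁ b<p = b<p
    ... | inj₂ refl = ⊥-elim (distinct copy₁)
    1<p+1-b : 1 < suc p ∸ b
    1<p+1-b = subst (1 <_) (sym (+-∸-assoc 1 (<⇒≤ b<p))) (s≤s (m<n⇒0<n∸m b<p))

-- Counting phrase ends

bit : Bool → ℕ
bit true  = 1
bit false = 0

bit≤1 : ∀ b → bit b ≤ 1
bit≤1 true  = ≤-refl
bit≤1 false = z≤n

∑ : (m : ℕ) → (Fin m → ℕ) → ℕ
∑ zero    f = 0
∑ (suc m) f = f fzero + ∑ m (λ j → f (fsuc j))

∑-cong : ∀ m {f g : Fin m → ℕ} → (∀ j → f j ≡ g j) → ∑ m f ≡ ∑ m g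
∑-cong zero    f≗g = refl
∑-cong (suc m) f≗g = cong₂ _+_ (f≗g fzero) (∑-cong m (λ j → f≗g (fsuc j)))

∑-mono : ∀ m {f g : Fin m → ℕ} → (∀ j → f j ≤ g j) → ∑ m f ≤ ∑ m g
∑-mono zero    f≤g = z≤n
∑-mono (suc m) f≤g = +-mono-≤ (f≤g fzero) (∑-mono m (λ j → f≤g (fsuc j)))

∑-+ : ∀ m (f g : Fin m → ℕ) → ∑ m (λ j → f j + g j) ≡ ∑ m f + ∑ m g
∑-+ zero    f g = refl
∑-+ (suc m) f g = trans (cong (f fzero + g fzero +_) (∑-+ m _ _)) (interchange (f fzero) (g fzero) _ _)
  where
  interchange : ∀ a b c d → a + b + (c + d) ≡ a + c + (b + d)
  interchange = solve-∀

∑-const : ∀ m k → ∑ m (λ _ → k) ≡ m * k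
∑-const zero    k = refl
∑-const (suc m) k = cong (k +_) (∑-const m k)

countTrue : (ℕ → Bool) → ℕ → ℕ → ℕ
countTrue f a zero    = 0
countTrue f a (suc L) = bit (f a) + countTrue f (suc a) L

countTrue-++ : ∀ f a L₁ L₂ → countTrue f a (L₁ + L₂) ≡ countTrue f a L₁ + countTrue f (a + L₁) L₂
countTrue-++ f a zero     L₂ = cong (λ x → countTrue f x L₂) (sym (+-identityʳ a))
countTrue-++ f a (suc L₁) L₂ = trans (cong (bit (f a) +_) (trans (countTrue-++ f (suc a) L₁ L₂)
  (cong (λ x → countTrue f (suc a) L₁ + countTrue f x L₂) (sym (+-suc a L₁))))) (sym (+-assoc (bit (f a)) _ _))

countTrue-cong : ∀ {f g} a L → (∀ i → i < L → f (a + i) ≡ g (a + i)) → countTrue f a L ≡ countTrue g a L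
countTrue-cong         a zero    f≗g = refl
countTrue-cong {f} {g} a (suc L) f≗g =
  cong₂ _+_ (cong bit (subst (λ x → f x ≡ g x) (+-identityʳ a) (f≗g 0 z<s)))
            (countTrue-cong (suc a) L (λ i i<L → subst (λ x → f x ≡ g x) (+-suc a i) (f≗g (suc i) (s≤s i<L))))

countTrue-none : ∀ {f} a L → (∀ i → i < L → f (a + i) ≡ false) → countTrue f a L ≡ 0
countTrue-none a L none = trans (countTrue-cong a L none) (constFalse a L)
  where
  constFalse : ∀ a L → countTrue (λ _ → false) a L ≡ 0
  constFalse a zero    = refl
  constFalse a (suc L) = constFalse (suc a) L

countTrue-all : ∀ {f} a L → (∀ i → i < L → f (a + i) ≡ true) → countTrue f a L ≡ L
countTrue-all a L all = trans (countTrue-cong a L all) (constTrue a L)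
  where
  constTrue : ∀ a L → countTrue (λ _ → true) a L ≡ L
  constTrue a zero    = refl
  constTrue a (suc L) = cong suc (constTrue (suc a) L)

countTrue-blocks : ∀ f a k m → countTrue f a (k * m) ≡ ∑ m (λ j → countTrue f (a + k * toℕ j) k)
countTrue-blocks f a k zero    = cong (countTrue f a) (*-zeroʳ k)
countTrue-blocks f a k (suc m) = begin
  countTrue f a (k * suc m)                                      ≡⟨ cong (countTrue f a) (*-suc k m) ⟩
  countTrue f a (k + k * m)                                      ≡⟨ countTrue-++ f a k (k * m) ⟩
  countTrue f a k + countTrue f (a + k) (k * m)                  ≡⟨ cong₂ _+_ (cong (λ x → countTrue f x k) (sym a+k*0≡a))
                                                                             (countTrue-blocks f (a + k) k m) ⟩
  countTrue f (a + k * 0) k + ∑ m (λ j → countTrue f (a + k + k * toℕ j) k)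
                                                                 ≡⟨ cong (countTrue f (a + k * 0) k +_) (∑-cong m shifted) ⟩
  countTrue f (a + k * 0) k + ∑ m (λ j → countTrue f (a + k * suc (toℕ j)) k) ∎
  where
  open ≡-Reasoning
  a+k*0≡a : a + k * 0 ≡ a
  a+k*0≡a = trans (cong (a +_) (*-zeroʳ k)) (+-identityʳ a)
  shifted : ∀ j → countTrue f (a + k + k * toℕ j) k ≡ countTrue f (a + k * suc (toℕ j)) k
  shifted j = cong (λ x → countTrue f x k) (trans (+-assoc a k _) (cong (a +_) (sym (*-suc k (toℕ j)))))

isPhraseEnd-inside : ∀ {p} a₀ f₀ ps → a₀ ≤ p → suc p < a₀ + len f₀ → isPhraseEnd ((a₀ , f₀) ∷ ps) p ≡ false
isPhraseEnd-inside {p} a₀ f₀ ps a₀≤p p+1<e with findPhrase-∷ p a₀ f₀ ps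
... | inj₁ (found , _)  = trans (cong (endsAt p) found) (dec-false (suc p ≟ a₀ + len f₀) (<⇒≢ p+1<e))
... | inj₂ (_ , past)   = ⊥-elim (<⇒≱ (<-trans (n<1+n p) p+1<e) (past a₀≤p))

isPhraseEnd-past : ∀ {p} a₀ f₀ ps → a₀ + len f₀ ≤ p → isPhraseEnd ((a₀ , f₀) ∷ ps) p ≡ isPhraseEnd ps p
isPhraseEnd-past {p} a₀ f₀ ps e≤p with findPhrase-∷ p a₀ f₀ ps
... | inj₁ (_ , _ , p<e) = ⊥-elim (<⇒≱ p<e e≤p)
... | inj₂ (found , _)   = cong (endsAt p) found

ends-in-phrase≤1 : ∀ a₀ l src ps → countTrue (isPhraseEnd ((a₀ , phrase (suc l) src) ∷ ps)) a₀ (suc l) ≤ 1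
ends-in-phrase≤1 a₀ l src ps = begin
  countTrue f a₀ (suc l)                  ≡⟨ cong (countTrue f a₀) (+-comm 1 l) ⟩
  countTrue f a₀ (l + 1)                  ≡⟨ countTrue-++ f a₀ l 1 ⟩
  countTrue f a₀ l + (bit (f (a₀ + l)) + 0) ≡⟨ cong (_+ (bit (f (a₀ + l)) + 0)) (countTrue-none a₀ l not-last) ⟩
  bit (f (a₀ + l)) + 0                    ≤⟨ +-monoˡ-≤ 0 (bit≤1 _) ⟩
  1                                       ∎
  where
  open ≤-Reasoning
  f : ℕ → Bool
  f = isPhraseEnd ((a₀ , phrase (suc l) src) ∷ ps)
  not-last : ∀ i → i < l → f (a₀ + i) ≡ false
  not-last i i<l = isPhraseEnd-inside a₀ _ ps (m≤m+n a₀ i) (subst (_< a₀ + suc l) (+-suc a₀ i) (+-monoʳ-< a₀ (s≤s i<l)))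

endsBy : (N : ℕ) (x : ℕ × Phrase) → Dec (proj₁ x + len (proj₂ x) ≤ N)
endsBy N x = proj₁ x + len (proj₂ x) ≤? N

ends≤phrases : ∀ a₀ φ d → All (λ x → 1 ≤ len (proj₂ x)) (starts a₀ φ) →
  countTrue (isPhraseEnd (starts a₀ φ)) a₀ d ≤ length (filter (endsBy (a₀ + d)) (starts a₀ φ))
ends≤phrases a₀ [] d _ = ≤-reflexive (countTrue-none a₀ d (λ _ _ → refl))
ends≤phrases a₀ (phrase (suc l) src ∷ φ) d (_ ∷ 1≤ls) with suc l ≤? d
... | no l₀≰d = ≤-trans (≤-reflexive (countTrue-none a₀ d not-last)) z≤n
  where
  not-last : ∀ i → i < d → isPhraseEnd (starts a₀ (phrase (suc l) src ∷ φ)) (a₀ + i) ≡ false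
  not-last i i<d = isPhraseEnd-inside a₀ (phrase (suc l) src) (starts (a₀ + suc l) φ) (m≤m+n a₀ i)
    (subst (_< a₀ + suc l) (+-suc a₀ i) (+-monoʳ-< a₀ (≤-<-trans i<d (≰⇒> l₀≰d))))
... | yes l₀≤d with m≤n⇒∃[o]m+o≡n l₀≤d
...   | d′ , refl = begin
  countTrue f a₀ (suc l + d′)                                     ≡⟨ countTrue-++ f a₀ (suc l) d′ ⟩
  countTrue f a₀ (suc l) + countTrue f (a₀ + suc l) d′            ≤⟨ +-mono-≤ (ends-in-phrase≤1 a₀ l src ps) (≤-reflexive past) ⟩
  1 + countTrue (isPhraseEnd ps) (a₀ + suc l) d′                  ≤⟨ s≤s (ends≤phrases (a₀ + suc l) φ d′ 1≤ls) ⟩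
  1 + length (filter (endsBy (a₀ + suc l + d′)) ps)              ≡⟨ cong (λ N → 1 + length (filter (endsBy N) ps)) (+-assoc a₀ (suc l) d′) ⟩
  1 + length (filter (endsBy (a₀ + (suc l + d′))) ps)            ≡⟨ cong length head-ends ⟨
  length (filter (endsBy (a₀ + (suc l + d′))) ((a₀ , phrase (suc l) src) ∷ ps)) ∎
  where
  open ≤-Reasoning
  ps : List (ℕ × Phrase)
  ps = starts (a₀ + suc l) φ
  f : ℕ → Bool
  f = isPhraseEnd ((a₀ , phrase (suc l) src) ∷ ps)
  head-ends : filter (endsBy (a₀ + (suc l + d′))) ((a₀ , phrase (suc l) src) ∷ ps) ≡ (a₀ , phrase (suc l) src) ∷ filter (endsBy _) ps
  head-ends = filter-accept (endsBy _) (+-monoʳ-≤ a₀ (m≤m+n (suc l) d′))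
  past : countTrue f (a₀ + suc l) d′ ≡ countTrue (isPhraseEnd ps) (a₀ + suc l) d′
  past = countTrue-cong (a₀ + suc l) d′ (λ i _ → isPhraseEnd-past a₀ (phrase (suc l) src) ps (m≤m+n (a₀ + suc l) i))

one-of-two : ∀ x y → T (x ∨ y) → 1 ≤ bit x + bit y
one-of-two true  _    _ = s≤s z≤n
one-of-two false true _ = s≤s z≤n

four-forced-ends : ∀ f a → f (3 + a) ≡ true → f (8 + a) ≡ true → T (f (1 + a) ∨ f (2 + a)) → T (f (5 + a) ∨ f (6 + a)) →
                   4 + bit (f a) + bit (f (4 + a)) ≤ countTrue f a 9
four-forced-ends f a end₃ end₈ end₁₂ end₅₆ rewrite end₃ | end₈ = begin
  4 + x₀ + x₄                                          ≡⟨ shuffle x₀ x₄ ⟩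
  (x₀ + x₄) + (1 + 1) + 2                              ≤⟨ +-monoˡ-≤ 2 (+-monoʳ-≤ (x₀ + x₄) (+-mono-≤ one₁₂ one₅₆)) ⟩
  (x₀ + x₄) + ((x₁ + x₂) + (x₅ + x₆)) + 2              ≤⟨ +-monoʳ-≤ _ (m≤n+m 2 x₇) ⟩
  (x₀ + x₄) + ((x₁ + x₂) + (x₅ + x₆)) + (x₇ + 2)       ≡⟨ regroup x₀ x₁ x₂ x₄ x₅ x₆ x₇ ⟨
  x₀ + (x₁ + (x₂ + (1 + (x₄ + (x₅ + (x₆ + (x₇ + 1))))))) ∎
  where
  open ≤-Reasoning
  one₁₂ : 1 ≤ bit (f (1 + a)) + bit (f (2 + a))
  one₁₂ = one-of-two (f (1 + a)) (f (2 + a)) end₁₂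
  one₅₆ : 1 ≤ bit (f (5 + a)) + bit (f (6 + a))
  one₅₆ = one-of-two (f (5 + a)) (f (6 + a)) end₅₆
  x₀ x₁ x₂ x₄ x₅ x₆ x₇ : ℕ
  x₀ = bit (f a)
  x₁ = bit (f (1 + a))
  x₂ = bit (f (2 + a))
  x₄ = bit (f (4 + a))
  x₅ = bit (f (5 + a))
  x₆ = bit (f (6 + a))
  x₇ = bit (f (7 + a))
  regroup : ∀ x₀ x₁ x₂ x₄ x₅ x₆ x₇ → x₀ + (x₁ + (x₂ + (1 + (x₄ + (x₅ + (x₆ + (x₇ + 1))))))) ≡
                                      (x₀ + x₄) + ((x₁ + x₂) + (x₅ + x₆)) + (x₇ + 2)
  regroup = solve-∀
  shuffle : ∀ x y → 4 + x + y ≡ x + y + (1 + 1) + 2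
  shuffle = solve-∀

-- The ends at 3, 5, 8 and at 1 or 2 already account for the whole budget of four.
tight-block : ∀ f a → f a ≡ false → f (3 + a) ≡ true → f (4 + a) ≡ false → f (5 + a) ≡ true → f (8 + a) ≡ true →
              T (f (1 + a) ∨ f (2 + a)) → countTrue f a 9 ≤ 4 →
              f (6 + a) ≡ false × f (7 + a) ≡ false × (f (2 + a) ≡ true → f (1 + a) ≡ false)
tight-block f a end₀ end₃ end₄ end₅ end₈ end₁₂ ≤4 rewrite end₀ | end₃ | end₄ | end₅ | end₈
  with f (1 + a) | f (2 + a) | f (6 + a) | f (7 + a)
... | true  | false | false | false = refl , refl , λ ()
... | false | true  | false | false = refl , refl , λ _ → refl
... | false | false | _     | _     with () ← end₁₂
tight-block f a _ _ _ _ _ _ (s≤s (s≤s (s≤s (s≤s ())))) | true  | true  | true  | true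
tight-block f a _ _ _ _ _ _ (s≤s (s≤s (s≤s (s≤s ())))) | true  | true  | true  | false
tight-block f a _ _ _ _ _ _ (s≤s (s≤s (s≤s (s≤s ())))) | true  | true  | false | true
tight-block f a _ _ _ _ _ _ (s≤s (s≤s (s≤s (s≤s ())))) | true  | true  | false | false
tight-block f a _ _ _ _ _ _ (s≤s (s≤s (s≤s (s≤s ())))) | true  | false | true  | true
tight-block f a _ _ _ _ _ _ (s≤s (s≤s (s≤s (s≤s ())))) | true  | false | true  | false
tight-block f a _ _ _ _ _ _ (s≤s (s≤s (s≤s (s≤s ())))) | true  | false | false | true
tight-block f a _ _ _ _ _ _ (s≤s (s≤s (s≤s (s≤s ())))) | false | true  | true  | true
tight-block f a _ _ _ _ _ _ (s≤s (s≤s (s≤s (s≤s ())))) | false | true  | true  | false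
tight-block f a _ _ _ _ _ _ (s≤s (s≤s (s≤s (s≤s ())))) | false | true  | false | true

concatFin : ∀ {A : Set} m → (Fin m → List A) → List A
concatFin zero    g = []
concatFin (suc m) g = g fzero ++ concatFin m (λ j → g (fsuc j))

length-concatFin : ∀ {A : Set} m (g : Fin m → List A) → length (concatFin m g) ≡ ∑ m (λ j → length (g j))
length-concatFin zero    g = refl
length-concatFin (suc m) g = trans (length-++ (g fzero)) (cong (length (g fzero) +_) (length-concatFin m (λ j → g (fsuc j))))

∈-concatFin : ∀ {A : Set} {x : A} m (g : Fin m → List A) j → x ∈ g j → x ∈ concatFin m g
∈-concatFin (suc m) g fzero    x∈ = ∈-++⁺ˡ x∈
∈-concatFin (suc m) g (fsuc j) x∈ = ∈-++⁺ʳ (g fzero) (∈-concatFin m (λ j → g (fsuc j)) j x∈)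

∣p∪q∣≤∣p∣+∣q∣ : ∀ {n} (p q : Subset n) → ∣ p ∪ q ∣ ≤ ∣ p ∣ + ∣ q ∣
∣p∪q∣≤∣p∣+∣q∣ []            []      = z≤n
∣p∪q∣≤∣p∣+∣q∣ (inside ∷ p)  (x ∷ q) = s≤s (≤-trans (∣p∪q∣≤∣p∣+∣q∣ p q) (+-monoʳ-≤ ∣ p ∣ (∣p∣≤∣x∷p∣ x q)))
∣p∪q∣≤∣p∣+∣q∣ (outside ∷ p) (inside ∷ q) = ≤-trans (s≤s (∣p∪q∣≤∣p∣+∣q∣ p q)) (≤-reflexive (sym (+-suc ∣ p ∣ ∣ q ∣)))
∣p∪q∣≤∣p∣+∣q∣ (outside ∷ p) (outside ∷ q) = ∣p∪q∣≤∣p∣+∣q∣ p q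

fromList : ∀ {n} → List (Fin n) → Subset n
fromList = foldr (λ x S → ⁅ x ⁆ ∪ S) ∅

∣fromList∣≤length : ∀ {n} (xs : List (Fin n)) → ∣ fromList xs ∣ ≤ length xs
∣fromList∣≤length {n} []       = ≤-reflexive (∣⊥∣≡0 n)
∣fromList∣≤length      (x ∷ xs) = begin
  ∣ ⁅ x ⁆ ∪ fromList xs ∣        ≤⟨ ∣p∪q∣≤∣p∣+∣q∣ ⁅ x ⁆ (fromList xs) ⟩
  ∣ ⁅ x ⁆ ∣ + ∣ fromList xs ∣    ≡⟨ cong (_+ ∣ fromList xs ∣) (∣⁅x⁆∣≡1 x) ⟩
  1 + ∣ fromList xs ∣            ≤⟨ s≤s (∣fromList∣≤length xs) ⟩
  1 + length xs                  ∎
  where open ≤-Reasoning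

∈-fromList : ∀ {n} {x : Fin n} {xs} → x ∈ xs → x ∈ₛ fromList xs
∈-fromList {xs = y ∷ ys} (here refl) = x∈p∪q⁺ (inj₁ (x∈⁅x⁆ y))
∈-fromList {xs = y ∷ ys} (there x∈) = x∈p∪q⁺ (inj₂ (∈-fromList x∈))

headΣ : ∀ {m} {P : Fin (suc m) → Set} → Maybe (P fzero) → List (Σ (Fin (suc m)) P)
headΣ nothing  = []
headΣ (just x) = (fzero , x) ∷ []

shiftΣ : ∀ {m} {P : Fin (suc m) → Set} → Σ (Fin m) (λ j → P (fsuc j)) → Σ (Fin (suc m)) P
shiftΣ (j , x) = fsuc j , x

collect : ∀ {m} {P : Fin m → Set} → ((j : Fin m) → Maybe (P j)) → List (Σ (Fin m) P)
collect {zero}      w = []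
collect {suc m} {P} w = headΣ {P = P} (w fzero) ++ map (shiftΣ {P = P}) (collect (λ j → w (fsuc j)))

length-collect : ∀ {m} {P : Fin m → Set} (w : (j : Fin m) → Maybe (P j)) → length (collect w) ≡ ∑ m (λ j → bit (is-just (w j)))
length-collect {zero}      w = refl
length-collect {suc m} {P} w = begin
  length (headΣ {P = P} (w fzero) ++ map shift rest)         ≡⟨ length-++ (headΣ {P = P} (w fzero)) ⟩
  length (headΣ {P = P} (w fzero)) + length (map shift rest) ≡⟨ cong₂ _+_ (length-head (w fzero)) (trans (length-map shift rest) length-rest) ⟩
  bit (is-just (w fzero)) + ∑ m (λ j → bit (is-just (w (fsuc j)))) ∎
  where
  open ≡-Reasoning
  shift : Σ (Fin m) (λ j → P (fsuc j)) → Σ (Fin (suc m)) P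
  shift = shiftΣ
  rest : List (Σ (Fin m) (λ j → P (fsuc j)))
  rest = collect (λ j → w (fsuc j))
  length-rest : length rest ≡ ∑ m (λ j → bit (is-just (w (fsuc j))))
  length-rest = length-collect (λ j → w (fsuc j))
  length-head : ∀ x → length (headΣ {P = P} x) ≡ bit (is-just x)
  length-head (just _) = refl
  length-head nothing  = refl

unique-collect : ∀ {m} {P : Fin m → Set} (w : (j : Fin m) → Maybe (P j)) → Unique (map proj₁ (collect w))
unique-collect {zero}      w = []
unique-collect {suc m} {P} w = unique-head (w fzero)
  where
  rest : List (Σ (Fin m) (λ j → P (fsuc j)))
  rest = collect (λ j → w (fsuc j))
  shifted : map proj₁ (map (shiftΣ {P = P}) rest) ≡ map fsuc (map proj₁ rest)
  shifted = trans (sym (map-∘ rest)) (map-∘ rest)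
  unique-rest : Unique (map proj₁ (map (shiftΣ {P = P}) rest))
  unique-rest = subst Unique (sym shifted) (Unique.map⁺ fsuc-injective (unique-collect (λ j → w (fsuc j))))
  unique-head : ∀ x → Unique (map proj₁ (headΣ {P = P} x ++ map shiftΣ rest))
  unique-head nothing  = unique-rest
  unique-head (just _) = subst (All (fzero ≢_)) (sym shifted) (Allₚ.map⁺ (universal (λ _ ()) _)) ∷ unique-rest

choose : ∀ {A : Set} → Bool → Bool → Bool → A → A → List A
choose true  true  _     p q = p ∷ q ∷ []
choose true  false _     p q = p ∷ []
choose false true  _     p q = q ∷ []
choose false false true  p q = p ∷ []
choose false false false p q = []

choose-first : ∀ {A : Set} e₄ x (p q : A) → p ∈ choose true e₄ x p q
choose-first true  x p q = here refl
choose-first false x p q = here refl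

choose-second : ∀ {A : Set} e₀ x (p q : A) → q ∈ choose e₀ true x p q
choose-second true  x p q = there (here refl)
choose-second false x p q = here refl

choose-cases : ∀ {A : Set} e₀ e₄ x (p q : A) →
               (p ∈ choose e₀ e₄ x p q ⊎ q ∈ choose e₀ e₄ x p q) ⊎ (e₀ ≡ false × e₄ ≡ false × x ≡ false)
choose-cases true  e₄    x     p q = inj₁ (inj₁ (choose-first e₄ x p q))
choose-cases false true  x     p q = inj₁ (inj₂ (here refl))
choose-cases false false true  p q = inj₁ (inj₁ (here refl))
choose-cases false false false p q = inj₂ (refl , refl , refl)

length-choose : ∀ {A : Set} e₀ e₄ b S (p q : A) → 4 + bit e₀ + bit e₄ ≤ S →
                length (choose e₀ e₄ (b ∨ (5 ≤ᵇ S)) p q) + 4 ≤ bit b + S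
length-choose true  true  b     S p q 6≤S = m≤n⇒m≤o+n (bit b) 6≤S
length-choose true  false b     S p q 5≤S = m≤n⇒m≤o+n (bit b) 5≤S
length-choose false true  b     S p q 5≤S = m≤n⇒m≤o+n (bit b) 5≤S
length-choose false false true  S p q 4≤S = s≤s 4≤S
length-choose false false false S p q 4≤S with 5 ≤ᵇ S in 5≤ᵇS
... | true  = ≤ᵇ⇒≤ 5 S (subst T (sym 5≤ᵇS) _)
... | false = 4≤S

no-witness : ∀ {k} {P : Fin k → Set} (d : Dec (∃ P)) → is-just (dec⇒maybe d) ≡ false → ∀ o → ¬ P o
no-witness (no ¬∃) _ o Po = ¬∃ (o , Po)

∨-false⁻ : ∀ {a b} → (a ∨ b) ≡ false → a ≡ false × b ≡ false
∨-false⁻ {false} {false} _ = refl , refl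

≤ᵇ-false⇒> : ∀ {m n} → (m ≤ᵇ n) ≡ false → n < m
≤ᵇ-false⇒> {m} {n} m≰ᵇn = ≰⇒> (λ m≤n → subst T m≰ᵇn (≤⇒≤ᵇ m≤n))

length-if : ∀ {A : Set} b (x : A) → length (if b then x ∷ [] else []) ≡ bit b
length-if true  x = refl
length-if false x = refl

-- The string α^(1)

block-< : ∀ k {i n o} → i < n → o < k → o + k * i < k * n
block-< k {i} {n} {o} i<n o<k = begin-strict
  o + k * i  <⟨ +-monoˡ-< (k * i) o<k ⟩
  k + k * i  ≡⟨ *-suc k i ⟨
  k * suc i  ≤⟨ *-monoʳ-≤ k i<n ⟩
  k * n      ∎
  where open ≤-Reasoning

offsetView : ∀ B r → r < B ⊎ ∃ λ r′ → r ≡ B + r′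
offsetView B r with r <? B
... | yes r<B = inj₁ r<B
... | no  r≮B = inj₂ (r ∸ B , sym (m+[n∸m]≡n (≮⇒≥ r≮B)))

module Alpha {n m : ℕ} (G : Graph n m) where

  endpoint₁ endpoint₂ : Fin m → Fin n
  endpoint₁ j = proj₁ (edge G j)
  endpoint₂ j = proj₂ (edge G j)

  vP vQ : Fin m → ℕ
  vP j = toℕ (endpoint₁ j)
  vQ j = toℕ (endpoint₂ j)

  Y : Fin m → List Sym
  Y j = sv' (vP j) ∷ sv (vP j) ∷ se (toℕ j) ∷ dol (toℕ j)
      ∷ sv' (vQ j) ∷ sv (vQ j) ∷ se (toℕ j) ∷ dol (toℕ j) ∷ he (toℕ j) ∷ []

  Yblock≡Y : ∀ j → Yblock G j ≡ Y j
  Yblock≡Y j with edge G j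
  ... | _ = refl

  α : List Sym
  α = alpha1 G

  #P #PX #α : ℕ
  #P  = 2 * n + 2 * m
  #PX = #P + 3 * n
  #α  = #PX + 9 * m

  private
    Pv Pe : List Sym
    Pv = concatMap (λ i → sv i ∷ hp i ∷ []) (upTo n)
    Pe = concatMap (λ i → se i ∷ hp (n + i) ∷ []) (upTo m)

    length-Pv : length Pv ≡ 2 * n
    length-Pv = trans (length-concatMap _ 2 (λ _ → refl) (upTo n)) (cong (2 *_) (length-applyUpTo id n))

    length-Pe : length Pe ≡ 2 * m
    length-Pe = trans (length-concatMap _ 2 (λ _ → refl) (upTo m)) (cong (2 *_) (length-applyUpTo id m))

    length-P : length (Pstr G) ≡ #P
    length-P = trans (length-++ Pv) (cong₂ _+_ length-Pv length-Pe)

    length-X : length (Xstr G) ≡ 3 * n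
    length-X = trans (length-concatMap _ 3 (λ _ → refl) (upTo n)) (cong (3 *_) (length-applyUpTo id n))

    |Yblock|≡9 : ∀ j → length (Yblock G j) ≡ 9
    |Yblock|≡9 j = cong length (Yblock≡Y j)

    length-Y : length (Ystr G) ≡ 9 * m
    length-Y = trans (length-concatMap (Yblock G) 9 |Yblock|≡9 (allFin m)) (cong (9 *_) (length-tabulate {n = m} id))

  length-PX : length (Pstr G ++ Xstr G) ≡ #PX
  length-PX = trans (length-++ (Pstr G)) (cong₂ _+_ length-P length-X)

  length-α : length α ≡ #α
  length-α = begin
    length (Pstr G ++ Xstr G ++ Ystr G)         ≡⟨ cong length (++-assoc (Pstr G) (Xstr G) (Ystr G)) ⟨
    length ((Pstr G ++ Xstr G) ++ Ystr G)       ≡⟨ length-++ (Pstr G ++ Xstr G) ⟩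
    length (Pstr G ++ Xstr G) + length (Ystr G) ≡⟨ cong₂ _+_ length-PX length-Y ⟩
    #α                                           ∎
    where open ≡-Reasoning

  #P≤#PX : #P ≤ #PX
  #P≤#PX = m≤m+n #P (3 * n)

  #PX≤Y : ∀ j o → #PX ≤ o + Yoffset G j
  #PX≤Y j o = m≤n⇒m≤o+n o (subst (_≤ Yoffset G j) length-PX (m≤m+n _ (9 * toℕ j)))

  #P≤Y : ∀ j o → #P ≤ o + Yoffset G j
  #P≤Y j o = ≤-trans #P≤#PX (#PX≤Y j o)

  Y<#α : ∀ j {o} → o < 9 → o + Yoffset G j < #α
  Y<#α j {o} o<9 = begin-strict
    o + (length (Pstr G ++ Xstr G) + 9 * toℕ j) ≡⟨ cong (λ x → o + (x + 9 * toℕ j)) length-PX ⟩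
    o + (#PX + 9 * toℕ j)                       ≡⟨ x+[y+z]≡y+[x+z] o #PX _ ⟩
    #PX + (o + 9 * toℕ j)                       <⟨ +-monoʳ-< #PX (block-< 9 (toℕ<n j) o<9) ⟩
    #α                                          ∎
    where open ≤-Reasoning

  at-Pv : ∀ {i o} → i < n → o < 2 → at α (o + 2 * i) ≡ at (sv i ∷ hp i ∷ []) o
  at-Pv {i} {o} i<n o<2 = begin
    at α (o + 2 * i)                                  ≡⟨ at-++ˡ (Pstr G) _ (subst (_ <_) (sym length-P) (<-≤-trans in-Pv (m≤m+n (2 * n) (2 * m)))) ⟩
    at (Pv ++ Pe) (o + 2 * i)                          ≡⟨ at-++ˡ Pv Pe (subst (_ <_) (sym length-Pv) in-Pv) ⟩
    at Pv (o + 2 * i)                                  ≡⟨ at-concatMap-lookup _ 2 (λ _ → refl) (upTo n) (at-applyUpTo id n i<n) o<2 ⟩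
    at (sv i ∷ hp i ∷ []) o                            ∎
    where
    open ≡-Reasoning
    in-Pv : o + 2 * i < 2 * n
    in-Pv = block-< 2 i<n o<2

  at-Pe : ∀ {i o} → i < m → o < 2 → at α (2 * n + (o + 2 * i)) ≡ at (se i ∷ hp (n + i) ∷ []) o
  at-Pe {i} {o} i<m o<2 = begin
    at α (2 * n + (o + 2 * i))                        ≡⟨ at-++ˡ (Pstr G) _ (subst (_ <_) (sym length-P) (+-monoʳ-< (2 * n) (block-< 2 i<m o<2))) ⟩
    at (Pv ++ Pe) (2 * n + (o + 2 * i))                ≡⟨ cong (λ x → at (Pv ++ Pe) (x + (o + 2 * i))) (sym length-Pv) ⟩
    at (Pv ++ Pe) (length Pv + (o + 2 * i))            ≡⟨ at-++ʳ Pv Pe _ ⟩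
    at Pe (o + 2 * i)                                  ≡⟨ at-concatMap-lookup _ 2 (λ _ → refl) (upTo m) (at-applyUpTo id m i<m) o<2 ⟩
    at (se i ∷ hp (n + i) ∷ []) o                      ∎
    where open ≡-Reasoning

  at-X : ∀ {i o} → i < n → o < 3 → at α (#P + (o + 3 * i)) ≡ at (sv' i ∷ sv i ∷ hv i ∷ []) o
  at-X {i} {o} i<n o<3 = begin
    at α (#P + (o + 3 * i))                           ≡⟨ cong (λ x → at α (x + (o + 3 * i))) (sym length-P) ⟩
    at α (length (Pstr G) + (o + 3 * i))              ≡⟨ at-++ʳ (Pstr G) _ _ ⟩
    at (Xstr G ++ Ystr G) (o + 3 * i)                 ≡⟨ at-++ˡ (Xstr G) (Ystr G) (subst (_ <_) (sym length-X) (block-< 3 i<n o<3)) ⟩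
    at (Xstr G) (o + 3 * i)                           ≡⟨ at-concatMap-lookup _ 3 (λ _ → refl) (upTo n) (at-applyUpTo id n i<n) o<3 ⟩
    at (sv' i ∷ sv i ∷ hv i ∷ []) o                   ∎
    where open ≡-Reasoning

  at-Y : ∀ j {o} → o < 9 → at α (o + Yoffset G j) ≡ at (Y j) o
  at-Y j {o} o<9 = begin
    at α (o + (#PX′ + 9 * toℕ j))                     ≡⟨ cong (at α) (x+[y+z]≡y+[x+z] o #PX′ _) ⟩
    at α (#PX′ + (o + 9 * toℕ j))                     ≡⟨ cong (λ xs → at xs (#PX′ + (o + 9 * toℕ j))) (++-assoc (Pstr G) (Xstr G) (Ystr G)) ⟨
    at ((Pstr G ++ Xstr G) ++ Ystr G) (#PX′ + (o + 9 * toℕ j)) ≡⟨ at-++ʳ (Pstr G ++ Xstr G) (Ystr G) _ ⟩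
    at (Ystr G) (o + 9 * toℕ j)                       ≡⟨ at-concatMap-lookup (Yblock G) 9 |Yblock|≡9 (allFin m) (at-tabulate id j) o<9 ⟩
    at (Yblock G j) o                                 ≡⟨ cong (λ xs → at xs o) (Yblock≡Y j) ⟩
    at (Y j) o                                        ∎
    where
    open ≡-Reasoning
    #PX′ : ℕ
    #PX′ = length (Pstr G ++ Xstr G)

  data Region : ℕ → Set where
    inPv : ∀ i o → i < n → o < 2 → Region (o + 2 * i)
    inPe : ∀ i o → i < m → o < 2 → Region (2 * n + (o + 2 * i))
    inX  : ∀ i o → i < n → o < 3 → Region (#P + (o + 3 * i))
    inY  : ∀ j o → o < 9 → Region (o + Yoffset G j)

  region : ∀ {r} → r < #α → Region r
  region {r} r<#α with offsetView (2 * n) r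
  ... | inj₁ r<2n with divide-into-blocks r 2 n r<2n
  ...   | i , o , i<n , o<2 , refl = inPv i o i<n o<2
  region r<#α | inj₂ (r₁ , refl) with offsetView (2 * m) r₁
  ... | inj₁ r₁<2m with divide-into-blocks r₁ 2 m r₁<2m
  ...   | i , o , i<m , o<2 , refl = inPe i o i<m o<2
  region r<#α | inj₂ (r₁ , refl) | inj₂ (r₂ , refl) with offsetView (3 * n) r₂
  ... | inj₁ r₂<3n with divide-into-blocks r₂ 3 n r₂<3n
  ...   | i , o , i<n , o<3 , refl = subst Region (+-assoc (2 * n) (2 * m) _) (inX i o i<n o<3)
  region r<#α | inj₂ (r₁ , refl) | inj₂ (r₂ , refl) | inj₂ (r₃ , refl)
    with divide-into-blocks r₃ 9 m (+-cancelˡ-< #PX r₃ (9 * m) (subst (_< #α) r≡#PX+r₃ r<#α))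
    where
    r≡#PX+r₃ : 2 * n + (2 * m + (3 * n + r₃)) ≡ #PX + r₃
    r≡#PX+r₃ = trans (sym (+-assoc (2 * n) (2 * m) _)) (sym (+-assoc #P (3 * n) r₃))
  ... | t , o , t<m , o<9 , refl = subst Region r≡ (inY (fromℕ< t<m) o o<9)
    where
    r≡ : o + Yoffset G (fromℕ< t<m) ≡ 2 * n + (2 * m + (3 * n + (o + 9 * t)))
    r≡ = begin
      o + (length (Pstr G ++ Xstr G) + 9 * toℕ (fromℕ< t<m)) ≡⟨ cong₂ (λ x y → o + (x + 9 * y)) length-PX (toℕ-fromℕ< t<m) ⟩
      o + (#PX + 9 * t)                                       ≡⟨ x+[y+z]≡y+[x+z] o #PX _ ⟩
      #PX + (o + 9 * t)                                       ≡⟨ +-assoc #P (3 * n) _ ⟩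
      #P + (3 * n + (o + 9 * t))                              ≡⟨ +-assoc (2 * n) (2 * m) _ ⟩
      2 * n + (2 * m + (3 * n + (o + 9 * t)))                 ∎
      where open ≡-Reasoning

  data Occurrence (r : ℕ) : Sym → Set where
    Pv-vertex : ∀ {i} → i < n → r ≡ 2 * i               → Occurrence r (sv i)
    Pv-hash   : ∀ {i} → i < n → r ≡ 1 + 2 * i           → Occurrence r (hp i)
    Pe-edge   : ∀ {i} → i < m → r ≡ 2 * n + 2 * i       → Occurrence r (se i)
    Pe-hash   : ∀ {i} → i < m → r ≡ 2 * n + (1 + 2 * i) → Occurrence r (hp (n + i))
    X-copy    : ∀ {i} → i < n → r ≡ #P + 3 * i          → Occurrence r (sv' i)
    X-vertex  : ∀ {i} → i < n → r ≡ #P + (1 + 3 * i)    → Occurrence r (sv i)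
    X-hash    : ∀ {i} → i < n → r ≡ #P + (2 + 3 * i)    → Occurrence r (hv i)
    Y-copyP   : ∀ j → r ≡ Yoffset G j     → Occurrence r (sv' (vP j))
    Y-vertexP : ∀ j → r ≡ 1 + Yoffset G j → Occurrence r (sv (vP j))
    Y-edge₁   : ∀ j → r ≡ 2 + Yoffset G j → Occurrence r (se (toℕ j))
    Y-dollar₁ : ∀ j → r ≡ 3 + Yoffset G j → Occurrence r (dol (toℕ j))
    Y-copyQ   : ∀ j → r ≡ 4 + Yoffset G j → Occurrence r (sv' (vQ j))
    Y-vertexQ : ∀ j → r ≡ 5 + Yoffset G j → Occurrence r (sv (vQ j))
    Y-edge₂   : ∀ j → r ≡ 6 + Yoffset G j → Occurrence r (se (toℕ j))
    Y-dollar₂ : ∀ j → r ≡ 7 + Yoffset G j → Occurrence r (dol (toℕ j))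
    Y-hash    : ∀ j → r ≡ 8 + Yoffset G j → Occurrence r (he (toℕ j))

  occurrence : ∀ {r x} → at α r ≡ just x → Occurrence r x
  occurrence {r} α[r] with region (subst (r <_) length-α (at-just⇒< α r α[r]))
  ... | inPv i o i<n o<2 = occPv o (trans (sym α[r]) (at-Pv i<n o<2))
    where
    occPv : ∀ o {x} → just x ≡ at (sv i ∷ hp i ∷ []) o → Occurrence (o + 2 * i) x
    occPv 0 refl = Pv-vertex i<n refl
    occPv 1 refl = Pv-hash i<n refl
  ... | inPe i o i<m o<2 = occPe o (trans (sym α[r]) (at-Pe i<m o<2))
    where
    occPe : ∀ o {x} → just x ≡ at (se i ∷ hp (n + i) ∷ []) o → Occurrence (2 * n + (o + 2 * i)) x
    occPe 0 refl = Pe-edge i<m refl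
    occPe 1 refl = Pe-hash i<m refl
  ... | inX i o i<n o<3 = occX o (trans (sym α[r]) (at-X i<n o<3))
    where
    occX : ∀ o {x} → just x ≡ at (sv' i ∷ sv i ∷ hv i ∷ []) o → Occurrence (#P + (o + 3 * i)) x
    occX 0 refl = X-copy i<n refl
    occX 1 refl = X-vertex i<n refl
    occX 2 refl = X-hash i<n refl
  ... | inY j o o<9 = occY o (trans (sym α[r]) (at-Y j o<9))
    where
    occY : ∀ o {x} → just x ≡ at (Y j) o → Occurrence (o + Yoffset G j) x
    occY 0 refl = Y-copyP j refl
    occY 1 refl = Y-vertexP j refl
    occY 2 refl = Y-edge₁ j refl
    occY 3 refl = Y-dollar₁ j refl
    occY 4 refl = Y-copyQ j refl
    occY 5 refl = Y-vertexQ j refl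
    occY 6 refl = Y-edge₂ j refl
    occY 7 refl = Y-dollar₂ j refl
    occY 8 refl = Y-hash j refl

  firstOccurrence : Sym → ℕ
  firstOccurrence (sv i)   = 2 * i
  firstOccurrence (hp t)   = 1 + 2 * t
  firstOccurrence (se i)   = 2 * n + 2 * i
  firstOccurrence (sv' i)  = #P + 3 * i
  firstOccurrence (hv i)   = #P + (2 + 3 * i)
  firstOccurrence (dol i)  = 3 + (length (Pstr G ++ Xstr G) + 9 * i)
  firstOccurrence (he i)   = 8 + (length (Pstr G ++ Xstr G) + 9 * i)
  firstOccurrence (hh _ _) = 0    -- #^(i)_γ does not occur in α^(1)

  private
    Pe-hash-position : ∀ i → 1 + 2 * (n + i) ≡ 2 * n + (1 + 2 * i)
    Pe-hash-position i = trans (cong suc (*-distribˡ-+ 2 n i)) (sym (+-suc (2 * n) (2 * i)))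

    vertex<#P : ∀ {v o} → v < n → o < 2 → o + 2 * v < #P
    vertex<#P v<n o<2 = <-≤-trans (block-< 2 v<n o<2) (m≤m+n (2 * n) (2 * m))

    edge<#P : ∀ {i o} → i < m → o < 2 → 2 * n + (o + 2 * i) < #P
    edge<#P i<m o<2 = +-monoʳ-< (2 * n) (block-< 2 i<m o<2)

    copy<#PX : ∀ {v} → v < n → #P + 3 * v < #PX
    copy<#PX v<n = +-monoʳ-< #P (block-< 3 v<n (s≤s z≤n))

  firstOccurrence-≤ : ∀ {r x} → at α r ≡ just x → firstOccurrence x ≤ r
  firstOccurrence-≤ α[r] with occurrence α[r]
  ... | Pv-vertex _ refl    = ≤-refl
  ... | Pv-hash _ refl      = ≤-refl
  ... | Pe-edge _ refl      = ≤-refl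
  ... | Pe-hash {i} _ refl  = ≤-reflexive (Pe-hash-position i)
  ... | X-copy _ refl       = ≤-refl
  ... | X-vertex i<n refl   = ≤-trans (<⇒≤ (vertex<#P i<n (s≤s z≤n))) (m≤m+n #P _)
  ... | X-hash _ refl       = ≤-refl
  ... | Y-copyP j refl      = ≤-trans (<⇒≤ (copy<#PX (toℕ<n (endpoint₁ j)))) (#PX≤Y j 0)
  ... | Y-vertexP j refl    = ≤-trans (<⇒≤ (vertex<#P (toℕ<n (endpoint₁ j)) (s≤s z≤n))) (#P≤Y j 1)
  ... | Y-edge₁ j refl      = ≤-trans (<⇒≤ (edge<#P (toℕ<n j) (s≤s z≤n))) (#P≤Y j 2)
  ... | Y-dollar₁ j refl    = ≤-refl
  ... | Y-copyQ j refl      = ≤-trans (<⇒≤ (copy<#PX (toℕ<n (endpoint₂ j)))) (#PX≤Y j 4)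
  ... | Y-vertexQ j refl    = ≤-trans (<⇒≤ (vertex<#P (toℕ<n (endpoint₂ j)) (s≤s z≤n))) (#P≤Y j 5)
  ... | Y-edge₂ j refl      = ≤-trans (<⇒≤ (edge<#P (toℕ<n j) (s≤s z≤n))) (#P≤Y j 6)
  ... | Y-dollar₂ j refl    = +-monoˡ-≤ (Yoffset G j) (m≤m+n 3 4)
  ... | Y-hash j refl       = ≤-refl

  P-fresh : ∀ {r} → r < #P → ∃ λ x → at α r ≡ just x × firstOccurrence x ≡ r
  P-fresh r<#P with region (<-≤-trans r<#P (≤-trans #P≤#PX (m≤m+n #PX (9 * m))))
  ... | inPv i 0 i<n _ = sv i , at-Pv i<n (s≤s z≤n) , refl
  ... | inPv i 1 i<n _ = hp i , at-Pv i<n (s≤s (s≤s z≤n)) , refl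
  ... | inPe i 0 i<m _ = se i , at-Pe i<m (s≤s z≤n) , refl
  ... | inPe i 1 i<m _ = hp (n + i) , at-Pe i<m (s≤s (s≤s z≤n)) , Pe-hash-position i
  ... | inPv _ (suc (suc _)) _ (s≤s (s≤s ()))
  ... | inPe _ (suc (suc _)) _ (s≤s (s≤s ()))
  ... | inX i o _ _    = ⊥-elim (<⇒≱ r<#P (m≤m+n #P _))
  ... | inY j o _      = ⊥-elim (<⇒≱ r<#P (#P≤Y j o))

  unique-symbol : ∀ {r x y} → at α r ≡ just x → at α r ≡ just y → x ≡ y
  unique-symbol α[r]≡x α[r]≡y = just-injective (trans (sym α[r]≡x) α[r]≡y)

  vertex-then-edge : ∀ {r u k} → at α r ≡ just (sv u) → at α (suc r) ≡ just (se k) →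
    ∃ λ j → k ≡ toℕ j × (r ≡ 1 + Yoffset G j × u ≡ vP j ⊎ r ≡ 5 + Yoffset G j × u ≡ vQ j)
  vertex-then-edge α[r] α[r+1] with occurrence α[r]
  ... | Pv-vertex i<n refl with unique-symbol α[r+1] (at-Pv i<n (s≤s (s≤s z≤n)))
  ...   | ()
  vertex-then-edge α[r] α[r+1] | X-vertex {i} i<n refl
    with unique-symbol α[r+1] (trans (cong (at α) (sym (+-suc #P (1 + 3 * i)))) (at-X i<n (s≤s (s≤s (s≤s z≤n)))))
  ... | ()
  vertex-then-edge α[r] α[r+1] | Y-vertexP j refl with unique-symbol α[r+1] (at-Y j (m≤m+n 3 6))
  ... | refl = j , refl , inj₁ (refl , refl)
  vertex-then-edge α[r] α[r+1] | Y-vertexQ j refl with unique-symbol α[r+1] (at-Y j (m≤m+n 7 2))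
  ... | refl = j , refl , inj₂ (refl , refl)

  edge-then-dollar : ∀ {r k k′} → at α r ≡ just (se k) → at α (suc r) ≡ just (dol k′) →
    ∃ λ j → k ≡ toℕ j × (r ≡ 2 + Yoffset G j ⊎ r ≡ 6 + Yoffset G j)
  edge-then-dollar α[r] α[r+1] with occurrence α[r]
  ... | Pe-edge {i} i<m refl
    with unique-symbol α[r+1] (trans (cong (at α) (sym (+-suc (2 * n) (2 * i)))) (at-Pe i<m (s≤s (s≤s z≤n))))
  ...   | ()
  edge-then-dollar α[r] α[r+1] | Y-edge₁ j refl = j , refl , inj₁ refl
  edge-then-dollar α[r] α[r+1] | Y-edge₂ j refl = j , refl , inj₂ refl

-- Phrase ends of an LZ-parsing of α^(1), and the vertex cover they induce

module Analysis {n m : ℕ} (G : Graph n m) (rest : List Sym) (φ : Parsing) (lz : IsLZParsing (alpha1 G ++ rest) φ) where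

  open Alpha G
  open Phrases α rest φ lz

  private
    <|α| : ∀ {r} → r < #α → r < length α
    <|α| {r} = subst (r <_) (sym length-α)

    #PX≤#α : #PX ≤ #α
    #PX≤#α = m≤m+n #PX (9 * m)

  firstOccurrence-end : ∀ {p x} → p < #α → at α p ≡ just x → firstOccurrence x ≡ p → isEnd p ≡ true
  firstOccurrence-end {p} p<#α α[p] first = new-symbol⇒end (<|α| p<#α)
    (λ r<p α[r]≡α[p] → <⇒≱ r<p (subst (_≤ _) first (firstOccurrence-≤ (trans α[r]≡α[p] α[p]))))

  P-end : ∀ {r} → r < #P → isEnd r ≡ true
  P-end r<#P with P-fresh r<#P
  ... | x , α[r] , first = firstOccurrence-end (<-≤-trans r<#P (≤-trans #P≤#PX #PX≤#α)) α[r] first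

  X-copy-end : ∀ {i} → i < n → isEnd (#P + 3 * i) ≡ true
  X-copy-end i<n = firstOccurrence-end (<-≤-trans (+-monoʳ-< #P (block-< 3 i<n (s≤s z≤n))) #PX≤#α) (at-X i<n (s≤s z≤n)) refl

  X-hash-end : ∀ {i} → i < n → isEnd (#P + (2 + 3 * i)) ≡ true
  X-hash-end i<n = firstOccurrence-end (<-≤-trans (+-monoʳ-< #P (block-< 3 i<n (m≤m+n 3 0))) #PX≤#α) (at-X i<n (m≤m+n 3 0)) refl

  Y-dollar-end : ∀ j → isEnd (3 + Yoffset G j) ≡ true
  Y-dollar-end j = firstOccurrence-end (Y<#α j (m≤m+n 4 5)) (at-Y j (m≤m+n 4 5)) refl

  Y-hash-end : ∀ j → isEnd (8 + Yoffset G j) ≡ true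
  Y-hash-end j = firstOccurrence-end (Y<#α j ≤-refl) (at-Y j ≤-refl) refl

  private
    new-vertex-edge⇒end : ∀ j {o u} → o < 8 → at α (o + Yoffset G j) ≡ just (sv u) → at α (suc o + Yoffset G j) ≡ just (se (toℕ j)) →
      (∀ {r} → r < o + Yoffset G j → r ≡ 1 + Yoffset G j × u ≡ vP j ⊎ r ≡ 5 + Yoffset G j × u ≡ vQ j → ⊥) →
      T (isEnd (o + Yoffset G j) ∨ isEnd (suc o + Yoffset G j))
    new-vertex-edge⇒end j o<8 α[p] α[p+1] not-earlier = new-pair⇒end (<|α| (Y<#α j (s≤s o<8))) earlier
      where
      earlier : ∀ {r} → r < _ → at α r ≡ at α _ → at α (suc r) ≢ at α _
      earlier r<p α[r] α[r+1] with vertex-then-edge (trans α[r] α[p]) (trans α[r+1] α[p+1])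
      ... | j′ , j≡j′ , position with toℕ-injective j≡j′
      ...   | refl = not-earlier r<p position

  Y-end₁₂ : ∀ j → T (isEnd (1 + Yoffset G j) ∨ isEnd (2 + Yoffset G j))
  Y-end₁₂ j = new-vertex-edge⇒end j (m≤m+n 2 6) (at-Y j (m≤m+n 2 7)) (at-Y j (m≤m+n 3 6)) not-earlier
    where
    not-earlier : ∀ {r} → r < 1 + Yoffset G j → _ → ⊥
    not-earlier r<1+Y (inj₁ (refl , _)) = <-irrefl refl r<1+Y
    not-earlier r<1+Y (inj₂ (refl , _)) = <⇒≱ r<1+Y (+-monoˡ-≤ (Yoffset G j) (m≤m+n 1 4))

  Y-end₅₆ : ∀ j → T (isEnd (5 + Yoffset G j) ∨ isEnd (6 + Yoffset G j))
  Y-end₅₆ j = new-vertex-edge⇒end j (m≤m+n 6 2) (at-Y j (m≤m+n 6 3)) (at-Y j (m≤m+n 7 2)) not-earlier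
    where
    not-earlier : ∀ {r} → r < 5 + Yoffset G j → _ → ⊥
    not-earlier r<5+Y (inj₁ (_ , vQ≡vP)) = noLoop G j (toℕ-injective (sym vQ≡vP))
    not-earlier r<5+Y (inj₂ (refl , _))  = <-irrefl refl r<5+Y

  end-before-Y : ∀ j → ∃ λ p → suc p ≡ Yoffset G j × isEnd p ≡ true
  end-before-Y j = before (toℕ j) refl (toℕ<n j)
    where
    #PX′ : ℕ
    #PX′ = length (Pstr G ++ Xstr G)
    before : ∀ t → toℕ j ≡ t → t < m → ∃ λ p → suc p ≡ Yoffset G j × isEnd p ≡ true
    before zero j≡0 _ = #P + (2 + 3 * (n ∸ 1)) , position , X-hash-end n∸1<n
      where
      0<n : 0 < n
      0<n = <-≤-trans z<s (toℕ<n (endpoint₁ j))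
      n∸1<n : n ∸ 1 < n
      n∸1<n = ∸-monoʳ-< z<s 0<n
      position : suc (#P + (2 + 3 * (n ∸ 1))) ≡ #PX′ + 9 * toℕ j
      position = begin
        suc (#P + (2 + 3 * (n ∸ 1)))  ≡⟨ shift #P (n ∸ 1) ⟩
        #P + 3 * suc (n ∸ 1)          ≡⟨ cong (λ k → #P + 3 * k) (suc-pred n {{>-nonZero 0<n}}) ⟩
        #PX                           ≡⟨ trans (sym length-PX) (sym (+-identityʳ #PX′)) ⟩
        #PX′ + 9 * 0                  ≡⟨ cong (λ t → #PX′ + 9 * t) (sym j≡0) ⟩
        #PX′ + 9 * toℕ j              ∎
        where
        open ≡-Reasoning
        shift : ∀ a k → suc (a + (2 + 3 * k)) ≡ a + 3 * suc k
        shift = solve-∀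
    before (suc t) j≡t+1 t+1<m = 8 + Yoffset G (fromℕ< t<m) , position , Y-hash-end (fromℕ< t<m)
      where
      t<m : t < m
      t<m = <-trans (n<1+n t) t+1<m
      position : 9 + (#PX′ + 9 * toℕ (fromℕ< t<m)) ≡ #PX′ + 9 * toℕ j
      position = begin
        9 + (#PX′ + 9 * toℕ (fromℕ< t<m)) ≡⟨ cong (λ k → 9 + (#PX′ + 9 * k)) (toℕ-fromℕ< t<m) ⟩
        9 + (#PX′ + 9 * t)                ≡⟨ shift #PX′ t ⟩
        #PX′ + 9 * suc t                  ≡⟨ cong (λ k → #PX′ + 9 * k) (sym j≡t+1) ⟩
        #PX′ + 9 * toℕ j                  ∎
        where
        open ≡-Reasoning
        shift : ∀ a k → 9 + (a + 9 * k) ≡ a + 9 * suc k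
        shift = solve-∀

  -- A phrase ends at v_v in X_v, or at a copy of v'_v in a block Y_j at an endpoint v.
  data Marked (v : Fin n) : Set where
    in-X   : isEnd (suc (#P + 3 * toℕ v)) ≡ true → Marked v
    in-Y-P : ∀ j → endpoint₁ j ≡ v → isEnd (Yoffset G j) ≡ true → Marked v
    in-Y-Q : ∀ j → endpoint₂ j ≡ v → isEnd (4 + Yoffset G j) ≡ true → Marked v

  private
    hop≤1⇒source-hop≡0 : ∀ {q r} → hop φ q ≡ suc (hop φ r) → hop φ q ≤ 1 → hop φ r ≡ 0
    hop≤1⇒source-hop≡0 hop≡ hop≤1 = n≤0⇒n≡0 (s≤s⁻¹ (subst (_≤ 1) hop≡ hop≤1))

  -- The sources of q and q + 1 have hop-number 0, hence end phrases, and the source of q is an earlier copy of v'_v.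
  marked-by-copy : ∀ {p q v} → suc p ≡ q → isEnd p ≡ true → suc q < #α → isEnd q ≡ false → isEnd (suc q) ≡ false →
                   at α q ≡ just (sv' (toℕ v)) → at α (suc q) ≡ just (sv (toℕ v)) → hop φ q ≤ 1 → hop φ (suc q) ≤ 1 → Marked v
  marked-by-copy {v = v} refl end q+1<#α notEnd₀ notEnd₁ α[q] α[q+1] hop₀≤1 hop₁≤1 = from (occurrence (trans copy₀ α[q])) refl
    where
    sv'≢sv : ∀ {a b} → just (sv' a) ≢ just (sv b)
    sv'≢sv ()
    open CopiedStart (copiedStart end (<|α| q+1<#α) notEnd₀ notEnd₁ (λ eq → sv'≢sv (trans (sym α[q]) (trans eq α[q+1]))))
    source-end : isEnd source ≡ true
    source-end = hop≡0⇒end (<|α| (<-trans source<q (<-trans (n<1+n _) q+1<#α))) (hop≤1⇒source-hop≡0 hop₀ hop₀≤1)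
    source+1-end : isEnd (suc source) ≡ true
    source+1-end = hop≡0⇒end (<|α| (<-trans (s≤s source<q) q+1<#α)) (hop≤1⇒source-hop≡0 hop₁ hop₁≤1)
    from : ∀ {u} → Occurrence source (sv' u) → toℕ v ≡ u → Marked v
    from (X-copy _ source≡) refl = in-X (subst (λ x → isEnd (suc x) ≡ true) source≡ source+1-end)
    from (Y-copyP j source≡) v≡ = in-Y-P j (toℕ-injective (sym v≡)) (subst (λ x → isEnd x ≡ true) source≡ source-end)
    from (Y-copyQ j source≡) v≡ = in-Y-Q j (toℕ-injective (sym v≡)) (subst (λ x → isEnd x ≡ true) source≡ source-end)

  Y-edge-copy-end : ∀ j → isEnd (5 + Yoffset G j) ≡ true → isEnd (6 + Yoffset G j) ≡ false → isEnd (7 + Yoffset G j) ≡ false →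
                    hop φ (6 + Yoffset G j) ≤ 1 → isEnd (2 + Yoffset G j) ≡ true
  Y-edge-copy-end j end₅ notEnd₆ notEnd₇ hop₆≤1 =
    from (edge-then-dollar (trans copy₀ (at-Y j (m≤m+n 7 2))) (trans copy₁ (at-Y j (m≤m+n 8 1))))
    where
    se≢dol : ∀ {a b} → just (se a) ≢ just (dol b)
    se≢dol ()
    open CopiedStart (copiedStart end₅ (<|α| (Y<#α j (m≤m+n 8 1))) notEnd₆ notEnd₇
                        (λ eq → se≢dol (trans (sym (at-Y j (m≤m+n 7 2))) (trans eq (at-Y j (m≤m+n 8 1))))))
    source-end : isEnd source ≡ true
    source-end = hop≡0⇒end (<|α| (<-trans source<q (Y<#α j (m≤m+n 7 2)))) (hop≤1⇒source-hop≡0 hop₀ hop₆≤1)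
    from : (∃ λ j′ → toℕ j ≡ toℕ j′ × (source ≡ 2 + Yoffset G j′ ⊎ source ≡ 6 + Yoffset G j′)) → isEnd (2 + Yoffset G j) ≡ true
    from (j′ , j≡j′ , position) = at-2-or-6 (toℕ-injective j≡j′) position
      where
      at-2-or-6 : ∀ {j′} → j ≡ j′ → source ≡ 2 + Yoffset G j′ ⊎ source ≡ 6 + Yoffset G j′ → isEnd (2 + Yoffset G j) ≡ true
      at-2-or-6 refl (inj₁ source≡) = subst (λ x → isEnd x ≡ true) source≡ source-end
      at-2-or-6 refl (inj₂ source≡) = ⊥-elim (<-irrefl source≡ source<q)

  -- If v_q ends no phrase, the phrase after $_j starts with v'_q v_q. Otherwise no other end is left for 6 and 7, so the
  -- phrase at 6 copies e_j $_j from position 2, which then ends a phrase; so 1 does not, and Y_j starts with a copy of v'_p v_p.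
  good-block : ∀ j → (∀ (o : Fin 9) → hop φ (toℕ o + Yoffset G j) ≤ 1) →
               isEnd (Yoffset G j) ≡ false → isEnd (4 + Yoffset G j) ≡ false → countTrue isEnd (Yoffset G j) 9 ≤ 4 →
               Marked (endpoint₁ j) ⊎ Marked (endpoint₂ j)
  good-block j hops notEnd₀ notEnd₄ ≤4 = by-end₅ (isEnd (5 + Yoffset G j)) refl
    where
    by-end₅ : ∀ b → isEnd (5 + Yoffset G j) ≡ b → Marked (endpoint₁ j) ⊎ Marked (endpoint₂ j)
    by-end₅ false notEnd₅ = inj₂ (marked-by-copy refl (Y-dollar-end j) (Y<#α j (m≤m+n 6 3)) notEnd₄ notEnd₅
                                    (at-Y j (m≤m+n 5 4)) (at-Y j (m≤m+n 6 3)) (hops (# 4)) (hops (# 5)))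
    by-end₅ true end₅ = inj₁ (marked-by-copy p+1≡Y p-end (Y<#α j (m≤m+n 2 7)) notEnd₀ notEnd₁
                                (at-Y j (m≤m+n 1 8)) (at-Y j (m≤m+n 2 7)) (hops (# 0)) (hops (# 1)))
      where
      tight : isEnd (6 + Yoffset G j) ≡ false × isEnd (7 + Yoffset G j) ≡ false ×
              (isEnd (2 + Yoffset G j) ≡ true → isEnd (1 + Yoffset G j) ≡ false)
      tight = tight-block isEnd (Yoffset G j) notEnd₀ (Y-dollar-end j) notEnd₄ end₅ (Y-hash-end j) (Y-end₁₂ j) ≤4
      notEnd₁ : isEnd (1 + Yoffset G j) ≡ false
      notEnd₁ = proj₂ (proj₂ tight) (Y-edge-copy-end j end₅ (proj₁ tight) (proj₁ (proj₂ tight)) (hops (# 6)))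
      p+1≡Y : suc (proj₁ (end-before-Y j)) ≡ Yoffset G j
      p+1≡Y = proj₁ (proj₂ (end-before-Y j))
      p-end : isEnd (proj₁ (end-before-Y j)) ≡ true
      p-end = proj₂ (proj₂ (end-before-Y j))

  bad? : ∀ j → Dec (∃ λ (o : Fin 9) → 2 ≤ hop φ (toℕ o + Yoffset G j))
  bad? j = any? (λ o → 2 ≤? hop φ (toℕ o + Yoffset G j))

  badness : ∀ j → Maybe (∃ λ (o : Fin 9) → 2 ≤ hop φ (toℕ o + Yoffset G j))
  badness j = dec⇒maybe (bad? j)

  isBad : Fin m → Bool
  isBad j = is-just (badness j)

  endsInY : Fin m → ℕ
  endsInY j = countTrue isEnd (Yoffset G j) 9

  X-vertex-end : Fin n → Bool
  X-vertex-end i = isEnd (suc (#P + 3 * toℕ i))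

  X-part : Fin n → List (Fin n)
  X-part i = if X-vertex-end i then i ∷ [] else []

  extra : Fin m → Bool
  extra j = isBad j ∨ (5 ≤ᵇ endsInY j)

  Y-part : Fin m → List (Fin n)
  Y-part j = choose (isEnd (Yoffset G j)) (isEnd (4 + Yoffset G j)) (extra j) (endpoint₁ j) (endpoint₂ j)

  cover : List (Fin n)
  cover = concatFin n X-part ++ concatFin m Y-part

  private
    ∈Y-part⇒∈cover : ∀ {v} j → v ∈ Y-part j → v ∈ cover
    ∈Y-part⇒∈cover j v∈ = ∈-++⁺ʳ (concatFin n X-part) (∈-concatFin m Y-part j v∈)

  marked⇒∈cover : ∀ {v} → Marked v → v ∈ cover
  marked⇒∈cover {v} (in-X end) =
    ∈-++⁺ˡ (∈-concatFin n X-part v (subst (λ b → v ∈ (if b then v ∷ [] else [])) (sym end) (here refl)))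
  marked⇒∈cover (in-Y-P j refl end₀) = ∈Y-part⇒∈cover j
    (subst (λ b → endpoint₁ j ∈ choose b (isEnd (4 + Yoffset G j)) (extra j) (endpoint₁ j) (endpoint₂ j)) (sym end₀)
           (choose-first (isEnd (4 + Yoffset G j)) (extra j) (endpoint₁ j) (endpoint₂ j)))
  marked⇒∈cover (in-Y-Q j refl end₄) = ∈Y-part⇒∈cover j
    (subst (λ b → endpoint₂ j ∈ choose (isEnd (Yoffset G j)) b (extra j) (endpoint₁ j) (endpoint₂ j)) (sym end₄)
           (choose-second (isEnd (Yoffset G j)) (extra j) (endpoint₁ j) (endpoint₂ j)))

  covers : ∀ j → endpoint₁ j ∈ cover ⊎ endpoint₂ j ∈ cover
  covers j = from-cases (choose-cases (isEnd (Yoffset G j)) (isEnd (4 + Yoffset G j)) (extra j) (endpoint₁ j) (endpoint₂ j))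
    where
    from-cases : (endpoint₁ j ∈ Y-part j ⊎ endpoint₂ j ∈ Y-part j) ⊎
                 (isEnd (Yoffset G j) ≡ false × isEnd (4 + Yoffset G j) ≡ false × extra j ≡ false) →
                 endpoint₁ j ∈ cover ⊎ endpoint₂ j ∈ cover
    from-cases (inj₁ (inj₁ p∈)) = inj₁ (∈Y-part⇒∈cover j p∈)
    from-cases (inj₁ (inj₂ q∈)) = inj₂ (∈Y-part⇒∈cover j q∈)
    from-cases (inj₂ (notEnd₀ , notEnd₄ , not-extra)) = Sum.map marked⇒∈cover marked⇒∈cover
      (good-block j (λ o → s≤s⁻¹ (≰⇒> (no-witness (bad? j) (proj₁ (∨-false⁻ not-extra)) o))) notEnd₀ notEnd₄
                  (s≤s⁻¹ (≤ᵇ-false⇒> (proj₂ (∨-false⁻ not-extra)))))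

  X-block-ends : ∀ i → countTrue isEnd (#P + 3 * toℕ i) 3 ≡ 2 + bit (X-vertex-end i)
  X-block-ends i = begin
    bit (isEnd a) + (x + (bit (isEnd (suc (suc a))) + 0)) ≡⟨ cong₂ (λ e₀ e₂ → bit e₀ + (x + (bit e₂ + 0))) end₀ end₂ ⟩
    1 + (x + 1)                                          ≡⟨ cong suc (+-comm x 1) ⟩
    2 + x                                                ∎
    where
    open ≡-Reasoning
    a x : ℕ
    a = #P + 3 * toℕ i
    x = bit (X-vertex-end i)
    end₀ : isEnd a ≡ true
    end₀ = X-copy-end (toℕ<n i)
    end₂ : isEnd (suc (suc a)) ≡ true
    end₂ = subst (λ r → isEnd r ≡ true) (trans (+-suc #P (suc (3 * toℕ i))) (cong suc (+-suc #P (3 * toℕ i)))) (X-hash-end (toℕ<n i))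

  ends-in-α : countTrue isEnd 0 #α ≡ #P + (∑ n (λ i → 2 + bit (X-vertex-end i)) + ∑ m endsInY)
  ends-in-α = begin
    countTrue isEnd 0 #α                                            ≡⟨ cong (countTrue isEnd 0) (+-assoc #P (3 * n) (9 * m)) ⟩
    countTrue isEnd 0 (#P + (3 * n + 9 * m))                        ≡⟨ countTrue-++ isEnd 0 #P (3 * n + 9 * m) ⟩
    countTrue isEnd 0 #P + countTrue isEnd #P (3 * n + 9 * m)       ≡⟨ cong₂ _+_ (countTrue-all 0 #P (λ _ → P-end))
                                                                                   (countTrue-++ isEnd #P (3 * n) (9 * m)) ⟩
    #P + (countTrue isEnd #P (3 * n) + countTrue isEnd #PX (9 * m)) ≡⟨ cong (#P +_) (cong₂ _+_ X-ends Y-ends) ⟩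
    #P + (∑ n (λ i → 2 + bit (X-vertex-end i)) + ∑ m endsInY)       ∎
    where
    open ≡-Reasoning
    X-ends : countTrue isEnd #P (3 * n) ≡ ∑ n (λ i → 2 + bit (X-vertex-end i))
    X-ends = trans (countTrue-blocks isEnd #P 3 n) (∑-cong n X-block-ends)
    Y-ends : countTrue isEnd #PX (9 * m) ≡ ∑ m endsInY
    Y-ends = trans (cong (λ a → countTrue isEnd a (9 * m)) (sym length-PX)) (countTrue-blocks isEnd (length (Pstr G ++ Xstr G)) 9 m)

  Y-part-bound : ∀ j → length (Y-part j) + 4 ≤ bit (isBad j) + endsInY j
  Y-part-bound j = length-choose (isEnd (Yoffset G j)) (isEnd (4 + Yoffset G j)) (isBad j) (endsInY j) (endpoint₁ j) (endpoint₂ j)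
    (four-forced-ends isEnd (Yoffset G j) (Y-dollar-end j) (Y-hash-end j) (Y-end₁₂ j) (Y-end₅₆ j))

  -- Every vertex in the cover is paid for by a phrase end of α^(1) beyond the 4n + 6m forced ones, or by a bad block.
  cover-bound : length cover + (4 * n + 6 * m) ≤ ∑ m (λ j → bit (isBad j)) + countTrue isEnd 0 #α
  cover-bound = begin
    length cover + (4 * n + 6 * m)             ≡⟨ cong (_+ (4 * n + 6 * m)) length-cover ⟩
    X + D + (4 * n + 6 * m)                    ≡⟨ regroup₁ X D n m ⟩
    X + (D + m * 4) + (#P + n * 2)             ≤⟨ +-monoˡ-≤ (#P + n * 2) (+-monoʳ-≤ X Y-bound) ⟩
    X + (B + E) + (#P + n * 2)                 ≡⟨ regroup₂ X B E n m ⟩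
    B + (#P + ((n * 2 + X) + E))               ≡⟨ cong (λ s → B + (#P + (s + E))) (sym X-sum) ⟩
    B + (#P + (∑ n (λ i → 2 + bit (X-vertex-end i)) + E)) ≡⟨ cong (B +_) ends-in-α ⟨
    B + countTrue isEnd 0 #α                   ∎
    where
    open ≤-Reasoning
    X D B E : ℕ
    X = ∑ n (λ i → bit (X-vertex-end i))
    D = ∑ m (λ j → length (Y-part j))
    B = ∑ m (λ j → bit (isBad j))
    E = ∑ m endsInY
    length-cover : length cover ≡ X + D
    length-cover = trans (length-++ (concatFin n X-part))
      (cong₂ _+_ (trans (length-concatFin n X-part) (∑-cong n (λ i → length-if (X-vertex-end i) i))) (length-concatFin m Y-part))
    X-sum : ∑ n (λ i → 2 + bit (X-vertex-end i)) ≡ n * 2 + X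
    X-sum = trans (∑-+ n (λ _ → 2) (λ i → bit (X-vertex-end i))) (cong (_+ X) (∑-const n 2))
    Y-bound : D + m * 4 ≤ B + E
    Y-bound = begin
      D + m * 4                                   ≡⟨ cong (D +_) (∑-const m 4) ⟨
      D + ∑ m (λ _ → 4)                           ≡⟨ ∑-+ m (λ j → length (Y-part j)) (λ _ → 4) ⟨
      ∑ m (λ j → length (Y-part j) + 4)           ≤⟨ ∑-mono m Y-part-bound ⟩
      ∑ m (λ j → bit (isBad j) + endsInY j)       ≡⟨ ∑-+ m (λ j → bit (isBad j)) endsInY ⟩
      B + E                                       ∎
    regroup₁ : ∀ X D n m → X + D + (4 * n + 6 * m) ≡ X + (D + m * 4) + ((2 * n + 2 * m) + n * 2)
    regroup₁ = solve-∀
    regroup₂ : ∀ X B E n m → X + (B + E) + ((2 * n + 2 * m) + n * 2) ≡ B + ((2 * n + 2 * m) + ((n * 2 + X) + E))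
    regroup₂ = solve-∀

  witnesses : List (ℕ × Fin m)
  witnesses = map (λ (j , o , _) → toℕ o + Yoffset G j , j) (collect badness)

  witnesses-bad : All (λ x → (Yoffset G (proj₂ x) ≤ proj₁ x) × (proj₁ x < Yoffset G (proj₂ x) + 9) × (2 ≤ hop φ (proj₁ x))) witnesses
  witnesses-bad = Allₚ.map⁺ (universal (λ (j , o , 2≤hop) → m≤n+m _ (toℕ o) , located j o , 2≤hop) _)
    where
    located : ∀ j (o : Fin 9) → toℕ o + Yoffset G j < Yoffset G j + 9
    located j o = subst (toℕ o + Yoffset G j <_) (+-comm 9 (Yoffset G j)) (+-monoˡ-< (Yoffset G j) (toℕ<n o))

  witnesses-unique : Unique (map proj₂ witnesses)
  witnesses-unique = subst Unique (map-∘ (collect badness)) (unique-collect badness)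

  enough-witnesses : ∀ k′ → (∀ S → IsVertexCover G S → k′ ≤ ∣ S ∣) →
                    k′ + (4 * n + 6 * m) ≤ length witnesses + prefixPhraseCount (length α) φ
  enough-witnesses k′ minimal = begin
    k′ + (4 * n + 6 * m)                                   ≤⟨ +-monoˡ-≤ _ k′≤|cover| ⟩
    length cover + (4 * n + 6 * m)                         ≤⟨ cover-bound ⟩
    ∑ m (λ j → bit (isBad j)) + countTrue isEnd 0 #α       ≤⟨ +-mono-≤ (≤-reflexive (sym length-witnesses)) ends≤phrases′ ⟩
    length witnesses + prefixPhraseCount (length α) φ      ∎
    where
    open ≤-Reasoning
    is-cover : IsVertexCover G (fromList cover)
    is-cover j = Sum.map ∈-fromList ∈-fromList (covers j)
    k′≤|cover| : k′ ≤ length cover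
    k′≤|cover| = ≤-trans (minimal (fromList cover) is-cover) (∣fromList∣≤length cover)
    length-witnesses : length witnesses ≡ ∑ m (λ j → bit (isBad j))
    length-witnesses = trans (length-map _ (collect badness)) (length-collect badness)
    ends≤phrases′ : countTrue isEnd 0 #α ≤ prefixPhraseCount (length α) φ
    ends≤phrases′ = subst (λ N → countTrue isEnd 0 #α ≤ prefixPhraseCount N φ) (sym length-α) (ends≤phrases 0 φ #α (proj₁ (proj₁ lz)))

α⁽¹⁾-prefix : ∀ {n m} (G : Graph n m) ℓ i → ∃ λ rest → alphaSeq G ℓ i ≡ alpha1 G ++ rest
α⁽¹⁾-prefix G ℓ zero    = [] , sym (++-identityʳ (alpha1 G))
α⁽¹⁾-prefix G ℓ (suc i) with α⁽¹⁾-prefix G ℓ i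
... | rest , α⁽ⁱ⁾≡ = rest ++ beta G (suc i) ℓ (alphaSeq G ℓ i) ,
  trans (cong (_++ beta G (suc i) ℓ (alphaSeq G ℓ i)) α⁽ⁱ⁾≡) (++-assoc (alpha1 G) rest _)

a+b≤c+d⇒a-t≤c : ∀ a b c d (t : ℤ) → a + b ≤ c + d → ℤ.+ d ≡ ℤ.+ b ℤ.+ t → ℤ.+ a ℤ.- t ℤ.≤ ℤ.+ c
a+b≤c+d⇒a-t≤c a b c d t a+b≤c+d d≡b+t = begin
  ℤ.+ a ℤ.- t                          ≡⟨ shuffle (ℤ.+ a) (ℤ.+ b) t ⟩
  (ℤ.+ a ℤ.+ ℤ.+ b) ℤ.- (ℤ.+ b ℤ.+ t)  ≡⟨ cong₂ ℤ._-_ (sym (ℤₚ.pos-+ a b)) (sym d≡b+t) ⟩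
  ℤ.+ (a + b) ℤ.- ℤ.+ d                ≤⟨ ℤₚ.+-monoˡ-≤ (ℤ.- ℤ.+ d) (ℤ.+≤+ a+b≤c+d) ⟩
  ℤ.+ (c + d) ℤ.- ℤ.+ d                ≡⟨ cong (ℤ._- ℤ.+ d) (ℤₚ.pos-+ c d) ⟩
  (ℤ.+ c ℤ.+ ℤ.+ d) ℤ.- ℤ.+ d          ≡⟨ cancel (ℤ.+ c) (ℤ.+ d) ⟩
  ℤ.+ c                                ∎
  where
  open ℤₚ.≤-Reasoning
  shuffle : ∀ x y z → x ℤ.- z ≡ (x ℤ.+ y) ℤ.- (y ℤ.+ z)
  shuffle = ℤ-Solver.solve-∀
  cancel : ∀ x y → (x ℤ.+ y) ℤ.- y ≡ x
  cancel = ℤ-Solver.solve-∀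

lemma3 : ∀ {n m : ℕ} (G : Graph n m) (c k ℓ k' : ℕ) (t : ℤ) (φ : Parsing) →
  1 ≤ c → k ≤ n → k < ℓ →
  MinVertexCoverSize G k' → k < k' →
  IsBLZParsing c (sG G c ℓ) φ →
  ℤ.+ (prefixPhraseCount (length (alpha1 G)) φ) ≡ ℤ.+ (4 * n + 6 * m) ℤ.+ t →
  t ℤ.≤ ℤ.+ k →
  Σ (List (ℕ × Fin m)) λ L →
    (ℤ.+ k' ℤ.- t ℤ.≤ ℤ.+ length L) ×
    All (λ x → (Yoffset G (proj₂ x) ≤ proj₁ x) × (proj₁ x < Yoffset G (proj₂ x) + 9)
               × (2 ≤ hop φ (proj₁ x))) L ×
    Unique (map proj₂ L)
lemma3 {n} {m} G c k ℓ k′ t φ _ _ _ (_ , minimal) _ (lz , _) phrases≡ _ =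
  witnesses , a+b≤c+d⇒a-t≤c k′ (4 * n + 6 * m) (length witnesses) _ t (enough-witnesses k′ minimal) phrases≡ ,
  witnesses-bad , witnesses-unique
  where
  prefix : ∃ λ rest → sG G c ℓ ≡ alpha1 G ++ rest
  prefix = α⁽¹⁾-prefix G ℓ (c ∸ 1)
  open Analysis G (proj₁ prefix) φ (subst (λ s → IsLZParsing s φ) (proj₂ prefix) lz)
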